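{- Let $n$ be a positive integer. The complete graph $K_n$ admits a $(C_6,\overline{C}_6)$-multidecomposition if and only if $n \equiv 0 \text{ or } 1 \pmod{3}$, $n \geq 6$, and $n \notin \{7,9,10\}$.
   Context: $C_6$ denotes the cycle on 6 vertices and $\overline{C}_6$ denotes its complement in $K_6$ (the graph on 6 vertices with 9 edges consisting of two disjoint triangles $\{a,b,c\}$, $\{d,e,f\}$ together with the perfect matching $\{a,d\},\{b,e\},\{c,f\}$). For graphs $G$ and $H$, a $(G,H)$-multidecomposition of $K_n$ is a partition of the edge set of $K_n$ into edge-disjoint subgraphs each isomorphic to $G$ or to $H$, such that at least one subgraph isomorphic to $G$ and at least one subgraph isomorphic to $H$ occur in the partition. -}

module Defs where

open import Data.Nat using (ℕ; zero; suc)
open import Data.Fin using (Fin; zero; suc)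
open import Data.Fin.Properties using (_≟_)
open import Data.Product using (_×_; _,_; Σ; ∃)
open import Data.List using (List; []; _∷_; map; concatMap)
open import Data.List.Relation.Unary.Any using (Any)
open import Relation.Binary.PropositionalEquality using (_≡_; _≢_)
open import Relation.Nullary using (yes; no)
open import Function.Definitions using (Injective)

data Shape : Set where
  cycle6 co-cycle6 : Shape

v0 v1 v2 v3 v4 v5 : Fin 6
v0 = zero
v1 = suc zero
v2 = suc (suc zero)
v3 = suc (suc (suc zero))
v4 = suc (suc (suc (suc zero)))
v5 = suc (suc (suc (suc (suc zero))))

C6-edges : List (Fin 6 × Fin 6)
C6-edges = (v0 , v1) ∷ (v1 , v2) ∷ (v2 , v3) ∷ (v3 , v4) ∷ (v4 , v5) ∷ (v5 , v0) ∷ []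

-- Edge list of C̄₆ : triangles {a,b,c}={0,1,2}, {d,e,f}={3,4,5},
-- plus matching {0,3},{1,4},{2,5}  (9 edges)
C6bar-edges : List (Fin 6 × Fin 6)
C6bar-edges =
  (v0 , v1) ∷ (v1 , v2) ∷ (v0 , v2) ∷
  (v3 , v4) ∷ (v4 , v5) ∷ (v3 , v5) ∷
  (v0 , v3) ∷ (v1 , v4) ∷ (v2 , v5) ∷ []

shapeEdges : Shape → List (Fin 6 × Fin 6)
shapeEdges cycle6    = C6-edges
shapeEdges co-cycle6 = C6bar-edges

record Block (n : ℕ) : Set where
  constructor block
  field
    shape : Shape
    emb   : Fin 6 → Fin n
    inj   : Injective _≡_ _≡_ emb

open Block public

-- Edges of K_n occupied by a block (as ordered pairs representing unordered edges).
blockEdges : ∀ {n} → Block n → List (Fin n × Fin n)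
blockEdges b = map (λ { (i , j) → emb b i , emb b j }) (shapeEdges (shape b))

edgeCount : ∀ {n} → List (Fin n × Fin n) → Fin n → Fin n → ℕ
edgeCount [] u v = zero
edgeCount ((x , y) ∷ es) u v with x ≟ u | y ≟ v | x ≟ v | y ≟ u
... | yes _ | yes _ | _     | _     = suc (edgeCount es u v)
... | _     | _     | yes _ | yes _ = suc (edgeCount es u v)
... | _     | _     | _     | _     = edgeCount es u v

IsEdgePartition : ∀ {n} → List (Block n) → Set
IsEdgePartition {n} bs =
  (u v : Fin n) → u ≢ v → edgeCount (concatMap blockEdges bs) u v ≡ 1

HasC6Multidecomposition : ℕ → Set
HasC6Multidecomposition n =
  ∃ λ (bs : List (Block n)) →
    IsEdgePartition bs
    × Any (λ b → shape b ≡ cycle6) bs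
    × Any (λ b → shape b ≡ co-cycle6) bs

module Submission where

-- Decompositions can be
-- relabelled along embeddings and superposed, which gives the gluing rules
-- K_{6+a} = K_6 ∪ K_a ∪ K_{6,a} and K_{13+a} = K_13 ∪ K_{1+a} ∪ K_{12,a} (one shared vertex).
-- Sufficiency: from explicit designs (K_6, K_9, K_10, K_13, K_15, K_19, K_{6,4}, K_{6,6}),
-- verified by evaluation, the gluing rules produce a mixed decomposition in each admissible
-- residue class modulo 6.  Necessity: if the copies partition K_n then for all vertex weights
-- s, t one has ∑_{edges xy} (s_x t_y + s_y t_x) + ∑ s t = (∑ s)(∑ t).  This counts the edges
-- (12A + 18B = n(n − 1), so n ≢ 2 mod 3), the degrees (2D_v + β_v = n − 1, where β_v copies
-- of C̄₆ pass through v) and the edges inside a vertex set, which C̄₆ bounds from below;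
-- small finite case checks then exclude n = 7, 9 and 10.

open import Defs
open import Data.Nat using (ℕ; _≤_; _%_)
open import Data.Product using (_×_)
open import Data.Sum using (_⊎_)
open import Function.Bundles using (_⇔_)
open import Relation.Binary.PropositionalEquality using (_≡_; _≢_)

open import Data.Bool using (Bool; true; false; T; _∧_)
open import Data.Bool.Properties using (T-∧)
open import Data.Empty using (⊥; ⊥-elim)
open import Data.Fin using (Fin; zero; suc; #_; splitAt; join)
open import Data.Fin.Properties
  using (+↔⊎; all?; splitAt-join; join-splitAt; suc-injective; injective⇒≤) renaming (_≟_ to _≟ᶠ_)
open import Data.List using (List; []; _∷_; _++_; map; concatMap)
open import Data.List.Properties using (map-∘; map-concatMap; concatMap-map; concatMap-cong; concatMap-++)
open import Data.List.Relation.Unary.All using (All; []; _∷_)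
import Data.List.Relation.Unary.All as All
import Data.List.Relation.Unary.All.Properties as AllProperties
open import Data.List.Relation.Unary.Any using (Any; here; there; satisfied)
open import Data.List.Relation.Unary.Any.Properties using (map⁺; ++⁺ˡ)
open import Data.Maybe using (Maybe; just; nothing; maybe′)
import Data.Maybe as Maybe
open import Data.Maybe.Properties using (just-injective)
import Data.Maybe.Properties as MaybeProperties
open import Data.Nat using (zero; suc; _+_; _*_; _<_; _/_; z≤n; s≤s; _≡ᵇ_)
import Data.Nat as ℕ
open import Data.Nat.DivMod using (m≡m%n+[m/n]*n; m%n<n; [m+kn]%n≡m%n; %-distribˡ-*)
open import Data.Nat.Properties
  using ( +-*-semiring; +-comm; +-assoc; +-suc; +-identityʳ; *-comm; *-assoc; *-zeroʳ; *-identityˡ; *-identityʳ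
        ; *-distribˡ-+; +-cancelʳ-≡; +-cancelˡ-≡; *-cancelˡ-≡; ≤-trans; ≤-reflexive; +-mono-≤; *-monoʳ-≤
        ; m≤m+n; m≤n+m; m≤m*n; ≤ᵇ⇒≤; allUpTo?; module ≤-Reasoning )
open import Data.Nat.Tactic.RingSolver using (solve-∀)
open import Algebra.Properties.Semiring.Sum +-*-semiring
  using (sum; sum-syntax; ∑-distrib-+; ∑-comm; *-distribˡ-sum; *-distribʳ-sum; sum-cong-≗; sum-replicate-zero)
open import Data.Product using (_,_; proj₁; proj₂; Σ)
open import Data.Sum using (inj₁; inj₂; [_,_]′)
import Data.Sum as Sum
open import Data.Sum.Properties using (swap-↔)
import Data.Sum.Properties as SumProperties
open import Data.Vec using (_∷_; []; lookup)
open import Function using (_∘_; _↔_; Inverse; mk↔ₛ′; mk⇔)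
open import Function.Bundles using (Equivalence)
open import Function.Construct.Identity using (↔-id)
open import Function.Construct.Symmetry using (↔-sym)
open import Function.Definitions using (Injective)
open import Relation.Binary.Definitions using (DecidableEquality)
open import Relation.Binary.PropositionalEquality using (refl; sym; trans; cong; cong₂; subst; subst₂; module ≡-Reasoning)
open import Relation.Nullary using (Dec; yes; no; ¬?; _→-dec_)
open import Relation.Nullary.Decidable using (True; False; toWitness; toWitnessFalse; _⊎-dec_)

listSum : {A : Set} → List A → (A → ℕ) → ℕ
listSum []       f = 0
listSum (x ∷ xs) f = f x + listSum xs f

infixl 10 listSum
syntax listSum xs (λ x → e) = ∑[ x ∈ xs ] e

listSum-++ : {A : Set} (xs ys : List A) (f : A → ℕ) →
  ∑[ x ∈ xs ++ ys ] f x ≡ ∑[ x ∈ xs ] f x + ∑[ x ∈ ys ] f x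
listSum-++ []       ys f = refl
listSum-++ (x ∷ xs) ys f = trans (cong (f x +_) (listSum-++ xs ys f)) (sym (+-assoc (f x) _ _))

listSum-cong : ∀ {A : Set} (xs : List A) {f g : A → ℕ} → (∀ x → f x ≡ g x) → ∑[ x ∈ xs ] f x ≡ ∑[ x ∈ xs ] g x
listSum-cong []       f≗g = refl
listSum-cong (x ∷ xs) f≗g = cong₂ _+_ (f≗g x) (listSum-cong xs f≗g)

listSum-+ : ∀ {A : Set} (xs : List A) (f g : A → ℕ) → ∑[ x ∈ xs ] (f x + g x) ≡ ∑[ x ∈ xs ] f x + ∑[ x ∈ xs ] g x
listSum-+ []       f g = refl
listSum-+ (x ∷ xs) f g = trans (cong (f x + g x +_) (listSum-+ xs f g)) (swap (f x) (g x) _ _)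
  where
    swap : ∀ a b c d → a + b + (c + d) ≡ a + c + (b + d)
    swap = solve-∀

listSum-*ˡ : ∀ {A : Set} (xs : List A) c (f : A → ℕ) → ∑[ x ∈ xs ] (c * f x) ≡ c * ∑[ x ∈ xs ] f x
listSum-*ˡ []       c f = sym (*-zeroʳ c)
listSum-*ˡ (x ∷ xs) c f = trans (cong (c * f x +_) (listSum-*ˡ xs c f)) (sym (*-distribˡ-+ c (f x) _))

listSum-*ʳ : ∀ {A : Set} (xs : List A) c (f : A → ℕ) → ∑[ x ∈ xs ] (f x * c) ≡ ∑[ x ∈ xs ] f x * c
listSum-*ʳ xs c f = trans (listSum-cong xs (λ x → *-comm (f x) c)) (trans (listSum-*ˡ xs c f) (*-comm c _))

listSum-mono : ∀ {A : Set} (xs : List A) {f g : A → ℕ} → (∀ x → f x ≤ g x) → ∑[ x ∈ xs ] f x ≤ ∑[ x ∈ xs ] g x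
listSum-mono []       f≤g = z≤n
listSum-mono (x ∷ xs) f≤g = +-mono-≤ (f≤g x) (listSum-mono xs f≤g)

listSum-concatMap : ∀ {A B : Set} (h : A → List B) (ys : List A) (f : B → ℕ) →
  ∑[ x ∈ concatMap h ys ] f x ≡ ∑[ y ∈ ys ] ∑[ x ∈ h y ] f x
listSum-concatMap h []       f = refl
listSum-concatMap h (y ∷ ys) f =
  trans (listSum-++ (h y) (concatMap h ys) f) (cong (∑[ x ∈ h y ] f x +_) (listSum-concatMap h ys f))

∑-listSum-comm : ∀ {A : Set} n (xs : List A) (f : Fin n → A → ℕ) →
  ∑[ u < n ] (∑[ x ∈ xs ] f u x) ≡ ∑[ x ∈ xs ] ∑[ u < n ] f u x
∑-listSum-comm n []       f = sum-replicate-zero n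
∑-listSum-comm n (x ∷ xs) f =
  trans (∑-distrib-+ (λ u → f u x) (λ u → ∑[ y ∈ xs ] f u y)) (cong (∑[ u < n ] f u x +_) (∑-listSum-comm n xs f))

listSum-map : ∀ {A B : Set} (f : A → B) (xs : List A) (g : B → ℕ) → ∑[ y ∈ map f xs ] g y ≡ ∑[ x ∈ xs ] g (f x)
listSum-map f []       g = refl
listSum-map f (x ∷ xs) g = cong (g (f x) +_) (listSum-map f xs g)

listSum-positive : ∀ {A : Set} {P : A → Set} (xs : List A) (f : A → ℕ) → (∀ x → P x → 1 ≤ f x) → Any P xs → 1 ≤ ∑[ x ∈ xs ] f x
listSum-positive (x ∷ xs) f pos (here px) = ≤-trans (pos x px) (m≤m+n (f x) _)
listSum-positive (x ∷ xs) f pos (there p) = ≤-trans (listSum-positive xs f pos p) (m≤n+m _ (f x))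

record Vertices : Set₁ where
  field
    Vertex : Set
    decide : DecidableEquality Vertex
open Vertices public

finV : ℕ → Vertices
finV n = record { Vertex = Fin n ; decide = _≟ᶠ_ }

_⊎V_ : Vertices → Vertices → Vertices
A ⊎V B = record { Vertex = Vertex A ⊎ Vertex B ; decide = SumProperties.≡-dec (decide A) (decide B) }

maybeV : Vertices → Vertices
maybeV A = record { Vertex = Maybe (Vertex A) ; decide = MaybeProperties.≡-dec (decide A) }

indicator : {P : Set} → Dec P → ℕ
indicator (yes _) = 1
indicator (no _)  = 0

δ : (V : Vertices) → Vertex V → Vertex V → ℕ
δ V x y = indicator (decide V x y)

δ-≡ : ∀ V {x y} → x ≡ y → δ V x y ≡ 1
δ-≡ V {x} {y} x≡y with decide V x y
... | yes _   = refl
... | no x≢y  = ⊥-elim (x≢y x≡y)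

δ-≢ : ∀ V {x y} → x ≢ y → δ V x y ≡ 0
δ-≢ V {x} {y} x≢y with decide V x y
... | yes x≡y = ⊥-elim (x≢y x≡y)
... | no _    = refl

δ-sym : ∀ V x y → δ V x y ≡ δ V y x
δ-sym V x y with decide V x y
... | yes x≡y = sym (δ-≡ V (sym x≡y))
... | no x≢y  = sym (δ-≢ V (x≢y ∘ sym))

module _ (V : Vertices) where

  δ-injective : ∀ {W} (f : Vertex V → Vertex W) → Injective _≡_ _≡_ f → ∀ x y → δ W (f x) (f y) ≡ δ V x y
  δ-injective {W} f f-inj x y with decide V x y
  ... | yes x≡y = δ-≡ W (cong f x≡y)
  ... | no x≢y  = δ-≢ W (x≢y ∘ f-inj)

  hits : Vertex V × Vertex V → Vertex V → Vertex V → ℕ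
  hits (x , y) u v = δ V x u * δ V y v + δ V x v * δ V y u

  multiplicity : List (Vertex V × Vertex V) → Vertex V → Vertex V → ℕ
  multiplicity es u v = ∑[ e ∈ es ] hits e u v

  multiplicity-sym : ∀ es u v → multiplicity es u v ≡ multiplicity es v u
  multiplicity-sym []             u v = refl
  multiplicity-sym ((x , y) ∷ es) u v =
    cong₂ _+_ (+-comm (δ V x u * δ V y v) _) (multiplicity-sym es u v)

  multiplicity-++ : ∀ es fs u v →
    multiplicity (es ++ fs) u v ≡ multiplicity es u v + multiplicity fs u v
  multiplicity-++ es fs u v = listSum-++ es fs (λ e → hits e u v)

edgeCount≡multiplicity : ∀ {n} (es : List (Fin n × Fin n)) u v → u ≢ v →
  edgeCount es u v ≡ multiplicity (finV n) es u v
edgeCount≡multiplicity []             u v u≢v = refl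
edgeCount≡multiplicity ((x , y) ∷ es) u v u≢v
  with x ≟ᶠ u | y ≟ᶠ v | x ≟ᶠ v | y ≟ᶠ u | edgeCount≡multiplicity es u v u≢v
... | yes refl | yes _ | yes refl | _     | rest = ⊥-elim (u≢v refl)
... | yes _    | yes _ | no _     | _     | rest = cong suc rest
... | yes _    | no _  | yes _    | yes _ | rest = cong suc rest
... | yes _    | no _  | yes _    | no _  | rest = rest
... | yes _    | no _  | no _     | _     | rest = rest
... | no _     | _     | yes _    | yes _ | rest = cong suc rest
... | no _     | _     | yes _    | no _  | rest = rest
... | no _     | _     | no _     | _     | rest = rest

Multigraph : Vertices → Set
Multigraph V = Vertex V → Vertex V → ℕ

record Copy (X : Set) : Set where
  constructor copy
  field
    copyShape         : Shape
    copyMap           : Fin 6 → X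
    copyMap-injective : Injective _≡_ _≡_ copyMap
open Copy public

both : {A B : Set} → (A → B) → A × A → B × B
both f e = f (proj₁ e) , f (proj₂ e)

copyEdges : {X : Set} → Copy X → List (X × X)
copyEdges c = map (both (copyMap c)) (shapeEdges (copyShape c))

allEdges : {X : Set} → List (Copy X) → List (X × X)
allEdges = concatMap copyEdges

Decomposes : (V : Vertices) → Multigraph V → List (Copy (Vertex V)) → Set
Decomposes V G cs = ∀ u v → u ≢ v → multiplicity V (allEdges cs) u v ≡ G u v

record Decomposition (V : Vertices) (G : Multigraph V) : Set where
  constructor decomposition
  field
    copies     : List (Copy (Vertex V))
    decomposes : Decomposes V G copies
open Decomposition public

Uses : {X : Set} → Shape → List (Copy X) → Set
Uses s = Any (λ c → copyShape c ≡ s)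

Mixed : {V : Vertices} {G : Multigraph V} → Decomposition V G → Set
Mixed d = Uses cycle6 (copies d) × Uses co-cycle6 (copies d)

-- An embedding of V into W whose image is decidable: `from` recognises the image.
record Embedding (V W : Vertices) : Set where
  field
    to      : Vertex V → Vertex W
    from    : Vertex W → Maybe (Vertex V)
    from-to : ∀ x → from (to x) ≡ just x
    to-from : ∀ {w x} → from w ≡ just x → to x ≡ w

module Relabelling {V W : Vertices} (emb : Embedding V W) where
  open Embedding emb

  to-injective : Injective _≡_ _≡_ to
  to-injective {x} {y} eq = just-injective (begin
    just x       ≡⟨ from-to x ⟨
    from (to x)  ≡⟨ cong from eq ⟩
    from (to y)  ≡⟨ from-to y ⟩
    just y       ∎)
    where open ≡-Reasoning

  outside-image : ∀ {w} → from w ≡ nothing → ∀ x → to x ≢ w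
  outside-image eq x refl with trans (sym (from-to x)) eq
  ... | ()

  transport : Multigraph V → Multigraph W
  transport G u v = maybe′ (λ x → maybe′ (G x) 0 (from v)) 0 (from u)

  relabelCopy : Copy (Vertex V) → Copy (Vertex W)
  relabelCopy c = copy (copyShape c) (to ∘ copyMap c) (copyMap-injective c ∘ to-injective)

  allEdges-relabel : ∀ cs → allEdges (map relabelCopy cs) ≡ map (both to) (allEdges cs)
  allEdges-relabel cs = begin
    concatMap copyEdges (map relabelCopy cs)      ≡⟨ concatMap-map copyEdges relabelCopy cs ⟩
    concatMap (copyEdges ∘ relabelCopy) cs        ≡⟨ concatMap-cong (λ c → map-∘ (shapeEdges (copyShape c))) cs ⟩
    concatMap (map (both to) ∘ copyEdges) cs      ≡⟨ map-concatMap (both to) copyEdges cs ⟨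
    map (both to) (concatMap copyEdges cs)        ∎
    where open ≡-Reasoning

  δ-to : ∀ x y → δ W (to x) (to y) ≡ δ V x y
  δ-to = δ-injective V {W} to to-injective

  multiplicity-to : ∀ es x y → multiplicity W (map (both to) es) (to x) (to y) ≡ multiplicity V es x y
  multiplicity-to []             x y = refl
  multiplicity-to ((a , b) ∷ es) x y =
    cong₂ _+_ (cong₂ _+_ (cong₂ _*_ (δ-to a x) (δ-to b y)) (cong₂ _*_ (δ-to a y) (δ-to b x)))
              (multiplicity-to es x y)

  multiplicity-outside : ∀ es {u} v → from u ≡ nothing → multiplicity W (map (both to) es) u v ≡ 0
  multiplicity-outside []             v out = refl
  multiplicity-outside ((a , b) ∷ es) {u} v out =
    cong₂ _+_ (cong₂ _+_ (cong (_* δ W (to b) v) (δ-≢ W (outside-image out a)))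
                         (trans (cong (δ W (to a) v *_) (δ-≢ W (outside-image out b))) (*-zeroʳ (δ W (to a) v))))
              (multiplicity-outside es v out)

  relabel : ∀ {G} → Decomposition V G → Decomposition W (transport G)
  copies (relabel d) = map relabelCopy (copies d)
  decomposes (relabel {G} (decomposition cs dec)) u v u≢v
    rewrite allEdges-relabel cs with from u in eu | from v in ev
  ... | just x  | just y  rewrite sym (to-from eu) | sym (to-from ev) =
    trans (multiplicity-to (allEdges cs) x y) (dec x y (u≢v ∘ cong to))
  ... | nothing | _       = multiplicity-outside (allEdges cs) v eu
  ... | just _  | nothing =
    trans (multiplicity-sym W (map (both to) (allEdges cs)) u v) (multiplicity-outside (allEdges cs) u ev)

  relabel-uses : ∀ {G s} (d : Decomposition V G) → Uses s (copies d) → Uses s (copies (relabel d))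
  relabel-uses _ = map⁺

_∪_ : ∀ {V G H} → Decomposition V G → Decomposition V H → Decomposition V (λ u v → G u v + H u v)
copies (d ∪ e) = copies d ++ copies e
decomposes (_∪_ {V} {G} {H} (decomposition cs dc) (decomposition ds dd)) u v u≢v = begin
  multiplicity V (allEdges (cs ++ ds)) u v                     ≡⟨ cong (λ es → multiplicity V es u v) (concatMap-++ copyEdges cs ds) ⟩
  multiplicity V (allEdges cs ++ allEdges ds) u v              ≡⟨ multiplicity-++ V (allEdges cs) (allEdges ds) u v ⟩
  multiplicity V (allEdges cs) u v + multiplicity V (allEdges ds) u v ≡⟨ cong₂ _+_ (dc u v u≢v) (dd u v u≢v) ⟩
  G u v + H u v                                                ∎
  where open ≡-Reasoning

infixr 5 _∪_

∪-usesˡ : ∀ {V G H s} (d : Decomposition V G) (e : Decomposition V H) → Uses s (copies d) → Uses s (copies (d ∪ e))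
∪-usesˡ d e = ++⁺ˡ

-- Only the multiplicities of pairs of distinct vertices matter.
reweigh : ∀ {V G H} → (∀ u v → u ≢ v → G u v ≡ H u v) → Decomposition V G → Decomposition V H
reweigh G≗H (decomposition cs d) = decomposition cs λ u v u≢v → trans (d u v u≢v) (G≗H u v u≢v)

fromInverse : ∀ {V W} → Vertex V ↔ Vertex W → Embedding V W
fromInverse iso = record
  { to      = Inverse.to iso
  ; from    = just ∘ Inverse.from iso
  ; from-to = cong just ∘ Inverse.strictlyInverseʳ iso
  ; to-from = λ { refl → Inverse.strictlyInverseˡ iso _ } }

inl : ∀ {A B} → Embedding A (A ⊎V B)
inl = record { to = inj₁ ; from = Sum.[ just , (λ _ → nothing) ] ; from-to = λ _ → refl
             ; to-from = λ { {inj₁ _} refl → refl } }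

inr : ∀ {A B} → Embedding B (A ⊎V B)
inr = record { to = inj₂ ; from = Sum.[ (λ _ → nothing) , just ] ; from-to = λ _ → refl
             ; to-from = λ { {inj₂ _} refl → refl } }

justE : ∀ {A} → Embedding A (maybeV A)
justE = record { to = just ; from = λ w → w ; from-to = λ _ → refl ; to-from = λ { refl → refl } }

maybeMap : ∀ {A B} → Embedding A B → Embedding (maybeV A) (maybeV B)
maybeMap {A} {B} e = record { to = Maybe.map to ; from = from′ ; from-to = from-to′ ; to-from = to-from′ }
  where
    open Embedding e
    from′ : Maybe (Vertex B) → Maybe (Maybe (Vertex A))
    from′ nothing  = just nothing
    from′ (just w) = Maybe.map just (from w)
    from-to′ : ∀ x → from′ (Maybe.map to x) ≡ just x
    from-to′ nothing  = refl
    from-to′ (just x) = cong (Maybe.map just) (from-to x)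
    to-from′ : ∀ {w x} → from′ w ≡ just x → Maybe.map to x ≡ w
    to-from′ {nothing} refl = refl
    to-from′ {just w} eq with from w in ew
    to-from′ {just w} refl | just y = cong just (to-from ew)

sumMap : ∀ {A A′ B B′} → Embedding A A′ → Embedding B B′ → Embedding (A ⊎V B) (A′ ⊎V B′)
sumMap {A} {A′} {B} {B′} e f = record { to = Sum.map (to e) (to f) ; from = from′ ; from-to = from-to′ ; to-from = to-from′ }
  where
    open Embedding
    from′ : Vertex A′ ⊎ Vertex B′ → Maybe (Vertex A ⊎ Vertex B)
    from′ (inj₁ a) = Maybe.map inj₁ (from e a)
    from′ (inj₂ b) = Maybe.map inj₂ (from f b)
    from-to′ : ∀ x → from′ (Sum.map (to e) (to f) x) ≡ just x
    from-to′ (inj₁ a) = cong (Maybe.map inj₁) (from-to e a)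
    from-to′ (inj₂ b) = cong (Maybe.map inj₂) (from-to f b)
    to-from′ : ∀ {w x} → from′ w ≡ just x → Sum.map (to e) (to f) x ≡ w
    to-from′ {inj₁ a} eq with from e a in ea
    to-from′ {inj₁ a} refl | just _ = cong inj₁ (to-from e ea)
    to-from′ {inj₂ b} eq with from f b in eb
    to-from′ {inj₂ b} refl | just _ = cong inj₂ (to-from f eb)

identity : ∀ {A} → Embedding A A
identity {A} = fromInverse (↔-id (Vertex A))

open Relabelling using (transport; relabel; relabel-uses)

complete : (V : Vertices) → Multigraph V
complete _ _ _ = 1

bipartite : (A B : Vertices) → Multigraph (A ⊎V B)
bipartite _ _ (inj₁ _) (inj₂ _) = 1
bipartite _ _ (inj₂ _) (inj₁ _) = 1
bipartite _ _ _        _        = 0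

completeJoin : ∀ {A B} → Decomposition A (complete A) → Decomposition B (complete B) →
  Decomposition (A ⊎V B) (bipartite A B) → Decomposition (A ⊎V B) (complete (A ⊎V B))
completeJoin {A} {B} a b c = reweigh covered (relabel (inl {A} {B}) a ∪ relabel (inr {A} {B}) b ∪ c)
  where
    covered : ∀ u v → u ≢ v →
      transport (inl {A} {B}) (complete A) u v + (transport (inr {A} {B}) (complete B) u v + bipartite A B u v) ≡ complete (A ⊎V B) u v
    covered (inj₁ _) (inj₁ _) _ = refl
    covered (inj₁ _) (inj₂ _) _ = refl
    covered (inj₂ _) (inj₁ _) _ = refl
    covered (inj₂ _) (inj₂ _) _ = refl

completeJoin-uses : ∀ {A B s} (a : Decomposition A (complete A)) (b : Decomposition B (complete B))
  (c : Decomposition (A ⊎V B) (bipartite A B)) → Uses s (copies a) → Uses s (copies (completeJoin a b c))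
completeJoin-uses {A} {B} a b c =
  ∪-usesˡ (relabel (inl {A} {B}) a) (relabel (inr {A} {B}) b ∪ c) ∘ relabel-uses (inl {A} {B}) a

hubJoin : ∀ {A B} → Decomposition (maybeV A) (complete (maybeV A)) → Decomposition (maybeV B) (complete (maybeV B)) →
  Decomposition (A ⊎V B) (bipartite A B) → Decomposition (maybeV (A ⊎V B)) (complete (maybeV (A ⊎V B)))
hubJoin {A} {B} a b c =
  reweigh covered (relabel (maybeMap (inl {A} {B})) a ∪ relabel (maybeMap (inr {A} {B})) b ∪ relabel (justE {A ⊎V B}) c)
  where
    covered : ∀ u v → u ≢ v →
      transport (maybeMap (inl {A} {B})) (complete (maybeV A)) u v + (transport (maybeMap (inr {A} {B})) (complete (maybeV B)) u v
        + transport (justE {A ⊎V B}) (bipartite A B) u v) ≡ complete (maybeV (A ⊎V B)) u v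
    covered nothing           nothing           u≢v = ⊥-elim (u≢v refl)
    covered nothing           (just (inj₁ _))   _   = refl
    covered nothing           (just (inj₂ _))   _   = refl
    covered (just (inj₁ _))   nothing           _   = refl
    covered (just (inj₂ _))   nothing           _   = refl
    covered (just (inj₁ _))   (just (inj₁ _))   _   = refl
    covered (just (inj₁ _))   (just (inj₂ _))   _   = refl
    covered (just (inj₂ _))   (just (inj₁ _))   _   = refl
    covered (just (inj₂ _))   (just (inj₂ _))   _   = refl

hubJoin-uses : ∀ {A B s} (a : Decomposition (maybeV A) (complete (maybeV A))) (b : Decomposition (maybeV B) (complete (maybeV B)))
  (c : Decomposition (A ⊎V B) (bipartite A B)) → Uses s (copies a) → Uses s (copies (hubJoin a b c))
hubJoin-uses {A} {B} a b c =
  ∪-usesˡ (relabel (maybeMap (inl {A} {B})) a) (relabel (maybeMap (inr {A} {B})) b ∪ relabel (justE {A ⊎V B}) c)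
  ∘ relabel-uses (maybeMap (inl {A} {B})) a

bipartiteJoin : ∀ {S A B} → Decomposition (S ⊎V A) (bipartite S A) → Decomposition (S ⊎V B) (bipartite S B) →
  Decomposition (S ⊎V (A ⊎V B)) (bipartite S (A ⊎V B))
bipartiteJoin {S} {A} {B} x y =
  reweigh covered (relabel (sumMap (identity {S}) (inl {A} {B})) x ∪ relabel (sumMap (identity {S}) (inr {A} {B})) y)
  where
    covered : ∀ u v → u ≢ v →
      transport (sumMap (identity {S}) (inl {A} {B})) (bipartite S A) u v
        + transport (sumMap (identity {S}) (inr {A} {B})) (bipartite S B) u v
        ≡ bipartite S (A ⊎V B) u v
    covered (inj₁ _)        (inj₁ _)        _ = refl
    covered (inj₁ _)        (inj₂ (inj₁ _)) _ = refl
    covered (inj₁ _)        (inj₂ (inj₂ _)) _ = refl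
    covered (inj₂ (inj₁ _)) (inj₁ _)        _ = refl
    covered (inj₂ (inj₂ _)) (inj₁ _)        _ = refl
    covered (inj₂ (inj₁ _)) (inj₂ (inj₁ _)) _ = refl
    covered (inj₂ (inj₁ _)) (inj₂ (inj₂ _)) _ = refl
    covered (inj₂ (inj₂ _)) (inj₂ (inj₁ _)) _ = refl
    covered (inj₂ (inj₂ _)) (inj₂ (inj₂ _)) _ = refl

bipartiteSwap : ∀ {A B} → Decomposition (A ⊎V B) (bipartite A B) → Decomposition (B ⊎V A) (bipartite B A)
bipartiteSwap {A} {B} x = reweigh covered (relabel swapE x)
  where
    swapE : Embedding (A ⊎V B) (B ⊎V A)
    swapE = fromInverse swap-↔
    covered : ∀ u v → u ≢ v → transport swapE (bipartite A B) u v ≡ bipartite B A u v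
    covered (inj₁ _) (inj₁ _) _ = refl
    covered (inj₁ _) (inj₂ _) _ = refl
    covered (inj₂ _) (inj₁ _) _ = refl
    covered (inj₂ _) (inj₂ _) _ = refl

bipartiteRename : ∀ {A A′ B B′} → Vertex A ↔ Vertex A′ → Vertex B ↔ Vertex B′ →
  Decomposition (A ⊎V B) (bipartite A B) → Decomposition (A′ ⊎V B′) (bipartite A′ B′)
bipartiteRename {A} {A′} {B} {B′} f g x = reweigh covered (relabel e x)
  where
    e : Embedding (A ⊎V B) (A′ ⊎V B′)
    e = sumMap (fromInverse f) (fromInverse g)
    covered : ∀ u v → u ≢ v → transport e (bipartite A B) u v ≡ bipartite A′ B′ u v
    covered (inj₁ _) (inj₁ _) _ = refl
    covered (inj₁ _) (inj₂ _) _ = refl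
    covered (inj₂ _) (inj₁ _) _ = refl
    covered (inj₂ _) (inj₂ _) _ = refl

Complete : ℕ → Set
Complete n = Decomposition (finV n) (complete (finV n))

MixedComplete : ℕ → Set
MixedComplete n = Σ (Complete n) Mixed

Bipartite : ℕ → ℕ → Set
Bipartite s a = Decomposition (finV s ⊎V finV a) (bipartite (finV s) (finV a))

renameComplete : ∀ {V} W → Vertex V ↔ Vertex W → Decomposition V (complete V) → Decomposition W (complete W)
renameComplete {V} W iso = relabel (fromInverse {V} {W} iso)

renameComplete-uses : ∀ {V s} W (iso : Vertex V ↔ Vertex W) (d : Decomposition V (complete V)) →
  Uses s (copies d) → Uses s (copies (renameComplete W iso d))
renameComplete-uses {V} W iso = relabel-uses (fromInverse {V} {W} iso)

suc↔maybe : ∀ {n} → Fin (suc n) ↔ Maybe (Fin n)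
suc↔maybe = mk↔ₛ′ to from (λ { nothing → refl ; (just _) → refl }) (λ { zero → refl ; (suc _) → refl })
  where
    to : ∀ {n} → Fin (suc n) → Maybe (Fin n)
    to zero    = nothing
    to (suc i) = just i
    from : ∀ {n} → Maybe (Fin n) → Fin (suc n)
    from nothing  = zero
    from (just i) = suc i

hub↔ : ∀ {m n} → Fin (suc (m + n)) ↔ Maybe (Fin m ⊎ Fin n)
hub↔ {m} {n} = mk↔ₛ′ to from to-from from-to
  where
    to : Fin (suc (m + n)) → Maybe (Fin m ⊎ Fin n)
    to zero    = nothing
    to (suc i) = just (splitAt m i)
    from : Maybe (Fin m ⊎ Fin n) → Fin (suc (m + n))
    from nothing  = zero
    from (just x) = suc (join m n x)
    to-from : ∀ x → to (from x) ≡ x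
    to-from nothing  = refl
    to-from (just x) = cong just (splitAt-join m n x)
    from-to : ∀ i → from (to i) ≡ i
    from-to zero    = refl
    from-to (suc i) = cong suc (join-splitAt m n i)

bipartiteAdd : ∀ {s a b} → Bipartite s a → Bipartite s b → Bipartite s (a + b)
bipartiteAdd {s} x y = bipartiteRename (↔-id (Fin s)) (↔-sym +↔⊎) (bipartiteJoin x y)

bipartiteStack : ∀ {s t a} → Bipartite s a → Bipartite t a → Bipartite (s + t) a
bipartiteStack x y = bipartiteSwap (bipartiteAdd (bipartiteSwap x) (bipartiteSwap y))

bipartiteSeries : ∀ {s r} → Bipartite s (6 + r) → Bipartite s 6 → ∀ q → Bipartite s (suc q * 6 + r)
bipartiteSeries base step zero    = base
bipartiteSeries base step (suc q) = bipartiteAdd step (bipartiteSeries base step q)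

-- Whether a list of copies decomposes a multigraph on Fin n is decidable; the explicit
-- designs below are certified by running this decision procedure.
decideDecomposes : ∀ n (G : Multigraph (finV n)) cs → Dec (Decomposes (finV n) G cs)
decideDecomposes n G cs =
  all? λ u → all? λ v → ¬? (u ≟ᶠ v) →-dec (multiplicity (finV n) (allEdges cs) u v ℕ.≟ G u v)

injective? : ∀ {m n} (f : Fin m → Fin n) → Dec (∀ i j → f i ≡ f j → i ≡ j)
injective? f = all? λ i → all? λ j → (f i ≟ᶠ f j) →-dec (i ≟ᶠ j)

onVertices : ∀ {n} → Shape → (a b c d e f : Fin n) →
  {True (injective? (lookup (a ∷ b ∷ c ∷ d ∷ e ∷ f ∷ [])))} → Copy (Fin n)
onVertices s a b c d e f {inj} = copy s (lookup (a ∷ b ∷ c ∷ d ∷ e ∷ f ∷ [])) (λ {i} {j} → toWitness inj i j)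

cycleOn coCycleOn : ∀ {n} (a b c d e f : Fin n) →
  {True (injective? (lookup (a ∷ b ∷ c ∷ d ∷ e ∷ f ∷ [])))} → Copy (Fin n)
cycleOn   a b c d e f {inj} = onVertices cycle6 a b c d e f {inj}
coCycleOn a b c d e f {inj} = onVertices co-cycle6 a b c d e f {inj}

completeByComputation : ∀ {n} cs → {True (decideDecomposes n (complete (finV n)) cs)} → Complete n
completeByComputation cs {ok} = decomposition cs (toWitness ok)

-- A design for K_{a,b} given on Fin (a + b), the first a vertices forming one side.
bipartiteByComputation : ∀ {a b} cs →
  {True (decideDecomposes (a + b) (λ u v → bipartite (finV a) (finV b) (splitAt a u) (splitAt a v)) cs)} →
  Bipartite a b
bipartiteByComputation {a} {b} cs {ok} = reweigh covered (relabel (fromInverse {finV (a + b)} {finV a ⊎V finV b} +↔⊎) (decomposition cs (toWitness ok)))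
  where
    covered : ∀ u v → u ≢ v →
      bipartite (finV a) (finV b) (splitAt a (join a b u)) (splitAt a (join a b v)) ≡ bipartite (finV a) (finV b) u v
    covered u v _ rewrite splitAt-join a b u | splitAt-join a b v = refl

K6 : MixedComplete 6
K6 = completeByComputation
  ( coCycleOn (# 1) (# 4) (# 0) (# 5) (# 3) (# 2)
  ∷ cycleOn   (# 0) (# 3) (# 1) (# 2) (# 4) (# 5)
  ∷ [])
  , there (here refl) , here refl

K9 : Complete 9
K9 = completeByComputation
  ( cycleOn (# 0) (# 1) (# 5) (# 2) (# 7) (# 3)
  ∷ cycleOn (# 0) (# 2) (# 1) (# 4) (# 6) (# 7)
  ∷ cycleOn (# 0) (# 4) (# 3) (# 6) (# 2) (# 8)
  ∷ cycleOn (# 0) (# 5) (# 7) (# 1) (# 8) (# 6)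
  ∷ cycleOn (# 1) (# 3) (# 8) (# 4) (# 5) (# 6)
  ∷ cycleOn (# 2) (# 3) (# 5) (# 8) (# 7) (# 4)
  ∷ [])

K10 : Complete 10
K10 = completeByComputation
  ( coCycleOn (# 0) (# 1) (# 2) (# 3) (# 4) (# 5)
  ∷ coCycleOn (# 0) (# 4) (# 6) (# 5) (# 7) (# 1)
  ∷ coCycleOn (# 0) (# 7) (# 8) (# 9) (# 2) (# 3)
  ∷ coCycleOn (# 1) (# 8) (# 9) (# 3) (# 6) (# 7)
  ∷ coCycleOn (# 2) (# 4) (# 8) (# 6) (# 9) (# 5)
  ∷ [])

K13 : MixedComplete 13
K13 = completeByComputation
  ( coCycleOn (# 4) (# 10) (# 9) (# 11) (# 3) (# 6)
  ∷ coCycleOn (# 7) (# 11) (# 2) (# 10) (# 0) (# 1)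
  ∷ coCycleOn (# 7) (# 8) (# 6) (# 5) (# 0) (# 4)
  ∷ coCycleOn (# 3) (# 5) (# 2) (# 1) (# 8) (# 9)
  ∷ cycleOn (# 0) (# 2) (# 8) (# 11) (# 9) (# 3)
  ∷ cycleOn (# 0) (# 6) (# 1) (# 4) (# 2) (# 12)
  ∷ cycleOn (# 0) (# 7) (# 3) (# 8) (# 12) (# 9)
  ∷ cycleOn (# 1) (# 5) (# 10) (# 6) (# 12) (# 7)
  ∷ cycleOn (# 1) (# 11) (# 10) (# 8) (# 4) (# 12)
  ∷ cycleOn (# 2) (# 6) (# 5) (# 11) (# 12) (# 10)
  ∷ cycleOn (# 3) (# 4) (# 7) (# 9) (# 5) (# 12)
  ∷ [])
  , there (there (there (there (here refl)))) , here refl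

K15 : MixedComplete 15
K15 = completeByComputation
  ( coCycleOn (# 3) (# 8) (# 1) (# 6) (# 4) (# 5)
  ∷ coCycleOn (# 0) (# 1) (# 4) (# 6) (# 2) (# 7)
  ∷ coCycleOn (# 2) (# 0) (# 8) (# 5) (# 3) (# 7)
  ∷ cycleOn (# 0) (# 5) (# 8) (# 6) (# 1) (# 10)
  ∷ cycleOn (# 0) (# 7) (# 11) (# 10) (# 5) (# 9)
  ∷ cycleOn (# 0) (# 11) (# 1) (# 7) (# 13) (# 14)
  ∷ cycleOn (# 0) (# 12) (# 1) (# 14) (# 10) (# 13)
  ∷ cycleOn (# 1) (# 9) (# 2) (# 11) (# 8) (# 13)
  ∷ cycleOn (# 2) (# 3) (# 9) (# 14) (# 8) (# 10)
  ∷ cycleOn (# 2) (# 4) (# 3) (# 14) (# 6) (# 13)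
  ∷ cycleOn (# 2) (# 12) (# 8) (# 9) (# 7) (# 14)
  ∷ cycleOn (# 3) (# 10) (# 4) (# 11) (# 14) (# 12)
  ∷ cycleOn (# 3) (# 11) (# 6) (# 12) (# 5) (# 13)
  ∷ cycleOn (# 4) (# 9) (# 12) (# 11) (# 5) (# 14)
  ∷ cycleOn (# 4) (# 12) (# 7) (# 10) (# 9) (# 13)
  ∷ cycleOn (# 6) (# 9) (# 11) (# 13) (# 12) (# 10)
  ∷ [])
  , there (there (there (here refl))) , here refl

K19 : MixedComplete 19
K19 = completeByComputation
  ( coCycleOn (# 3) (# 8) (# 1) (# 6) (# 4) (# 5)
  ∷ coCycleOn (# 0) (# 1) (# 4) (# 6) (# 2) (# 7)
  ∷ coCycleOn (# 2) (# 0) (# 8) (# 5) (# 3) (# 7)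
  ∷ cycleOn (# 0) (# 5) (# 9) (# 6) (# 8) (# 10)
  ∷ cycleOn (# 0) (# 7) (# 10) (# 1) (# 6) (# 11)
  ∷ cycleOn (# 0) (# 9) (# 1) (# 7) (# 13) (# 17)
  ∷ cycleOn (# 0) (# 12) (# 1) (# 11) (# 9) (# 16)
  ∷ cycleOn (# 0) (# 13) (# 1) (# 15) (# 5) (# 18)
  ∷ cycleOn (# 0) (# 14) (# 1) (# 18) (# 10) (# 15)
  ∷ cycleOn (# 1) (# 16) (# 2) (# 4) (# 14) (# 17)
  ∷ cycleOn (# 2) (# 3) (# 18) (# 15) (# 7) (# 9)
  ∷ cycleOn (# 2) (# 10) (# 3) (# 4) (# 15) (# 12)
  ∷ cycleOn (# 2) (# 11) (# 4) (# 12) (# 7) (# 14)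
  ∷ cycleOn (# 2) (# 13) (# 3) (# 11) (# 8) (# 17)
  ∷ cycleOn (# 2) (# 15) (# 6) (# 10) (# 9) (# 18)
  ∷ cycleOn (# 3) (# 9) (# 14) (# 13) (# 6) (# 12)
  ∷ cycleOn (# 3) (# 14) (# 5) (# 10) (# 11) (# 17)
  ∷ cycleOn (# 3) (# 15) (# 9) (# 8) (# 13) (# 16)
  ∷ cycleOn (# 4) (# 9) (# 12) (# 5) (# 11) (# 16)
  ∷ cycleOn (# 4) (# 10) (# 12) (# 14) (# 6) (# 17)
  ∷ cycleOn (# 4) (# 13) (# 12) (# 8) (# 16) (# 18)
  ∷ cycleOn (# 5) (# 8) (# 14) (# 15) (# 11) (# 13)
  ∷ cycleOn (# 5) (# 16) (# 10) (# 13) (# 15) (# 17)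
  ∷ cycleOn (# 6) (# 16) (# 17) (# 12) (# 11) (# 18)
  ∷ cycleOn (# 7) (# 11) (# 14) (# 16) (# 12) (# 18)
  ∷ cycleOn (# 7) (# 16) (# 15) (# 8) (# 18) (# 17)
  ∷ cycleOn (# 9) (# 13) (# 18) (# 14) (# 10) (# 17)
  ∷ [])
  , there (there (there (here refl))) , here refl

K6,4 : Bipartite 6 4
K6,4 = bipartiteByComputation
  ( cycleOn (# 6) (# 0) (# 7) (# 2) (# 9) (# 1)
  ∷ cycleOn (# 6) (# 2) (# 8) (# 3) (# 9) (# 5)
  ∷ cycleOn (# 6) (# 3) (# 7) (# 1) (# 8) (# 4)
  ∷ cycleOn (# 7) (# 4) (# 9) (# 0) (# 8) (# 5)
  ∷ [])

K6,6 : Bipartite 6 6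
K6,6 = bipartiteByComputation
  ( cycleOn (# 0) (# 6) (# 1) (# 11) (# 4) (# 7)
  ∷ cycleOn (# 0) (# 8) (# 1) (# 10) (# 2) (# 9)
  ∷ cycleOn (# 0) (# 10) (# 4) (# 6) (# 2) (# 11)
  ∷ cycleOn (# 1) (# 7) (# 5) (# 6) (# 3) (# 9)
  ∷ cycleOn (# 2) (# 7) (# 3) (# 11) (# 5) (# 8)
  ∷ cycleOn (# 3) (# 8) (# 4) (# 9) (# 5) (# 10)
  ∷ [])

-- Adding six vertices: K_{6+a} = K_6 ∪ K_a ∪ K_{6,a}; the copy of K_6 makes the result mixed.
extend6 : ∀ {a} → Complete a → Bipartite 6 a → MixedComplete (6 + a)
extend6 {a} ka b = renameComplete (finV (6 + a)) (↔-sym +↔⊎) joined , keep (proj₁ (proj₂ K6)) , keep (proj₂ (proj₂ K6))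
  where
    joined : Decomposition (finV 6 ⊎V finV a) (complete (finV 6 ⊎V finV a))
    joined = completeJoin (proj₁ K6) ka b
    keep : ∀ {s} → Uses s (copies (proj₁ K6)) → Uses s (copies (renameComplete (finV (6 + a)) (↔-sym +↔⊎) joined))
    keep = renameComplete-uses (finV (6 + a)) (↔-sym +↔⊎) joined ∘ completeJoin-uses (proj₁ K6) ka b

extend12 : ∀ {a} → Complete (suc a) → Bipartite 12 a → MixedComplete (12 + suc a)
extend12 {a} ka b = renameComplete (finV (12 + suc a)) (↔-sym hub↔) joined , keep (proj₁ (proj₂ K13)) , keep (proj₂ (proj₂ K13))
  where
    hubbed : ∀ {n} → Complete (suc n) → Decomposition (maybeV (finV n)) (complete (maybeV (finV n)))
    hubbed {n} = renameComplete (maybeV (finV n)) suc↔maybe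
    joined : Decomposition (maybeV (finV 12 ⊎V finV a)) (complete (maybeV (finV 12 ⊎V finV a)))
    joined = hubJoin (hubbed (proj₁ K13)) (hubbed ka) b
    keep : ∀ {s} → Uses s (copies (proj₁ K13)) → Uses s (copies (renameComplete (finV (12 + suc a)) (↔-sym hub↔) joined))
    keep = renameComplete-uses (finV (12 + suc a)) (↔-sym hub↔) joined
         ∘ hubJoin-uses (hubbed (proj₁ K13)) (hubbed ka) b
         ∘ renameComplete-uses (maybeV (finV 12)) suc↔maybe (proj₁ K13)

K6,8 : Bipartite 6 8
K6,8 = bipartiteAdd K6,4 K6,4

K6,10 : Bipartite 6 10
K6,10 = bipartiteAdd K6,4 K6,6

double : ∀ {a} → Bipartite 6 a → Bipartite 12 a
double x = bipartiteStack x x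

-- The infinite families, one for each admissible residue of n modulo 6; the indices are chosen
-- so that each gluing step lands on the next member definitionally.
-- n = 6, 12, 18, …
mixed0 : ∀ q → MixedComplete (suc q * 6 + 0)
mixed0 zero    = K6
mixed0 (suc q) = extend6 (proj₁ (mixed0 q)) (bipartiteSeries K6,6 K6,6 q)

-- n = 10, 16, 22, …  (mixed from 16 on)
complete4 : ∀ q → Complete (suc q * 6 + 4)
mixed4    : ∀ q → MixedComplete (suc (suc q) * 6 + 4)
complete4 zero    = K10
complete4 (suc q) = proj₁ (mixed4 q)
mixed4 q = extend6 (complete4 q) (bipartiteSeries K6,10 K6,6 q)

mixed1 : ∀ q → MixedComplete (suc (suc (suc q) * 6 + 0))
mixed1 zero          = K13
mixed1 (suc zero)    = K19
mixed1 (suc (suc q)) = extend12 (proj₁ (mixed1 q)) (double (bipartiteSeries K6,6 K6,6 (suc q)))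

-- n = 9, 15, 21, …  (mixed from 15 on)
complete3 : ∀ q → Complete (suc (suc q * 6 + 2))
mixed3    : ∀ q → MixedComplete (suc (suc (suc q) * 6 + 2))
complete3 zero    = K9
complete3 (suc q) = proj₁ (mixed3 q)
mixed3 zero    = K15
mixed3 (suc q) = extend12 (complete3 q) (double (bipartiteSeries K6,8 K6,6 q))

Admissible : ℕ → Set
Admissible n = (n % 3 ≡ 0 ⊎ n % 3 ≡ 1) × 6 ≤ n × n ≢ 7 × n ≢ 9 × n ≢ 10

sixes-mod3 : ∀ q r → (q * 6 + r) % 3 ≡ r % 3
sixes-mod3 q r = begin
  (q * 6 + r) % 3     ≡⟨ cong (_% 3) (+-comm (q * 6) r) ⟩
  (r + q * 6) % 3     ≡⟨ cong (λ m → (r + m) % 3) (*-assoc q 2 3) ⟨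
  (r + q * 2 * 3) % 3 ≡⟨ [m+kn]%n≡m%n r (q * 2) 3 ⟩
  r % 3               ∎
  where open ≡-Reasoning

refute : ∀ {m k} → m ≤ k → {False (m ℕ.≤? k)} → ⊥
refute m≤k {m≰k} = toWitnessFalse m≰k m≤k

residueTwo : ∀ {m} → m ≡ 2 → m ≡ 0 ⊎ m ≡ 1 → ⊥
residueTwo refl (inj₁ ())
residueTwo refl (inj₂ ())

-- Every admissible n has a mixed decomposition: read off n = 6q + r and use the family for r.
sufficiency : ∀ n → Admissible n → MixedComplete n
sufficiency n (mod3 , 6≤n , n≢7 , n≢9 , n≢10) =
  byResidue (n % 6) (n / 6) (m%n<n n 6) (trans (m≡m%n+[m/n]*n n 6) (+-comm (n % 6) (n / 6 * 6)))
  where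
    from : ∀ {m} → n ≡ m → MixedComplete m → MixedComplete n
    from n≡m = subst MixedComplete (sym n≡m)
    notTwo : ∀ q r → n ≡ q * 6 + r → r % 3 ≡ 2 → ⊥
    notTwo q r n≡ r≡2 = residueTwo (trans (cong (_% 3) n≡) (trans (sixes-mod3 q r) r≡2)) mod3
    byResidue : ∀ r q → r < 6 → n ≡ q * 6 + r → MixedComplete n
    byResidue 0 zero                _ n≡ = ⊥-elim (refute (subst (6 ≤_) n≡ 6≤n))
    byResidue 0 (suc q)             _ n≡ = from n≡ (mixed0 q)
    byResidue 1 zero                _ n≡ = ⊥-elim (refute (subst (6 ≤_) n≡ 6≤n))
    byResidue 1 (suc zero)          _ n≡ = ⊥-elim (n≢7 n≡)
    byResidue 1 (suc (suc q))       _ n≡ = from (trans n≡ (+-suc (suc (suc q) * 6) 0)) (mixed1 q)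
    byResidue 2 q                   _ n≡ = ⊥-elim (notTwo q 2 n≡ refl)
    byResidue 3 zero                _ n≡ = ⊥-elim (refute (subst (6 ≤_) n≡ 6≤n))
    byResidue 3 (suc zero)          _ n≡ = ⊥-elim (n≢9 n≡)
    byResidue 3 (suc (suc q))       _ n≡ = from (trans n≡ (+-suc (suc (suc q) * 6) 2)) (mixed3 q)
    byResidue 4 zero                _ n≡ = ⊥-elim (refute (subst (6 ≤_) n≡ 6≤n))
    byResidue 4 (suc zero)          _ n≡ = ⊥-elim (n≢10 n≡)
    byResidue 4 (suc (suc q))       _ n≡ = from n≡ (mixed4 q)
    byResidue 5 q                   _ n≡ = ⊥-elim (notTwo q 5 n≡ refl)
    byResidue (suc (suc (suc (suc (suc (suc _)))))) _ (s≤s (s≤s (s≤s (s≤s (s≤s (s≤s ())))))) _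

toBlock : ∀ {n} → Copy (Fin n) → Block n
toBlock c = block (copyShape c) (copyMap c) (copyMap-injective c)

blockEdges-toBlock : ∀ {n} (c : Copy (Fin n)) → blockEdges (toBlock c) ≡ copyEdges c
blockEdges-toBlock (copy cycle6    _ _) = refl
blockEdges-toBlock (copy co-cycle6 _ _) = refl

multidecomposition : ∀ {n} → MixedComplete n → HasC6Multidecomposition n
multidecomposition (decomposition cs dec , hasCycle , hasCoCycle) =
  map toBlock cs , partition , map⁺ hasCycle , map⁺ hasCoCycle
  where
    sameEdges : concatMap blockEdges (map toBlock cs) ≡ allEdges cs
    sameEdges = trans (concatMap-map blockEdges toBlock cs) (concatMap-cong blockEdges-toBlock cs)
    partition : IsEdgePartition (map toBlock cs)
    partition u v u≢v rewrite sameEdges = trans (edgeCount≡multiplicity (allEdges cs) u v u≢v) (dec u v u≢v)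

∑-zero : ∀ {n} (f : Fin n → ℕ) → (∀ i → f i ≡ 0) → ∑[ i < n ] f i ≡ 0
∑-zero {n} f f≗0 = trans (sum-cong-≗ f≗0) (sum-replicate-zero n)

∑-ones : ∀ n → ∑[ i < n ] 1 ≡ n
∑-ones zero    = refl
∑-ones (suc n) = cong suc (∑-ones n)

δᶠ : ∀ {n} → Fin n → Fin n → ℕ
δᶠ {n} = δ (finV n)

∑-δ : ∀ {n} (x : Fin n) (g : Fin n → ℕ) → ∑[ u < n ] (δᶠ x u * g u) ≡ g x
∑-δ {suc n} zero    g = begin
  1 * g zero + ∑[ u < n ] (0 * g (suc u)) ≡⟨ cong₂ _+_ (*-identityˡ (g zero)) (sum-replicate-zero n) ⟩
  g zero + 0                            ≡⟨ +-identityʳ (g zero) ⟩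
  g zero                                ∎
  where open ≡-Reasoning
∑-δ {suc n} (suc x) g = begin
  0 * g zero + ∑[ u < n ] (δᶠ (suc x) (suc u) * g (suc u)) ≡⟨ sum-cong-≗ (λ u → cong (_* g (suc u)) (δ-injective (finV n) {finV (suc n)} suc suc-injective x u)) ⟩
  ∑[ u < n ] (δᶠ x u * g (suc u))                          ≡⟨ ∑-δ x (λ u → g (suc u)) ⟩
  g (suc x)                                              ∎
  where open ≡-Reasoning

-- The quadratic identity behind all counting arguments: if a list of edges contains every
-- pair of distinct vertices exactly once and no loop, then for all vertex weights s and t
-- the edges account for (∑ s)(∑ t) apart from its diagonal part ∑ s t.
module Quadratic {n} (s t : Fin n → ℕ) where

  -- The contribution of the pair {x , y} to (∑ s)(∑ t).
  weight : Fin n × Fin n → ℕ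
  weight (x , y) = s x * t y + s y * t x

  private
    rearrange : ∀ a b c d su tv → su * tv * (a * b + c * d) ≡ a * (su * (b * tv)) + d * (su * (c * tv))
    rearrange = solve-∀

    pick : ∀ (a : Fin n → ℕ) y u → a u * (s u * ∑[ v < n ] (δᶠ y v * t v)) ≡ a u * (s u * t y)
    pick a y u = cong (λ z → a u * (s u * z)) (∑-δ y t)

  hits-sum : ∀ e → ∑[ u < n ] ∑[ v < n ] (s u * t v * hits (finV n) e u v) ≡ weight e
  hits-sum (x , y) = begin
    ∑[ u < n ] ∑[ v < n ] (s u * t v * (δᶠ x u * δᶠ y v + δᶠ x v * δᶠ y u))
      ≡⟨ sum-cong-≗ (λ u → sum-cong-≗ (λ v → rearrange (δᶠ x u) (δᶠ y v) (δᶠ x v) (δᶠ y u) (s u) (t v))) ⟩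
    ∑[ u < n ] ∑[ v < n ] (δᶠ x u * (s u * (δᶠ y v * t v)) + δᶠ y u * (s u * (δᶠ x v * t v)))
      ≡⟨ sum-cong-≗ (λ u → ∑-distrib-+ (λ v → δᶠ x u * (s u * (δᶠ y v * t v))) (λ v → δᶠ y u * (s u * (δᶠ x v * t v)))) ⟩
    ∑[ u < n ] (∑[ v < n ] (δᶠ x u * (s u * (δᶠ y v * t v))) + ∑[ v < n ] (δᶠ y u * (s u * (δᶠ x v * t v))))
      ≡⟨ sum-cong-≗ (λ u → cong₂ _+_ (pull (δᶠ x u) (s u) (λ v → δᶠ y v * t v)) (pull (δᶠ y u) (s u) (λ v → δᶠ x v * t v))) ⟩
    ∑[ u < n ] (δᶠ x u * (s u * ∑[ v < n ] (δᶠ y v * t v)) + δᶠ y u * (s u * ∑[ v < n ] (δᶠ x v * t v)))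
      ≡⟨ sum-cong-≗ (λ u → cong₂ _+_ (pick (δᶠ x) y u) (pick (δᶠ y) x u)) ⟩
    ∑[ u < n ] (δᶠ x u * (s u * t y) + δᶠ y u * (s u * t x))
      ≡⟨ ∑-distrib-+ (λ u → δᶠ x u * (s u * t y)) (λ u → δᶠ y u * (s u * t x)) ⟩
    ∑[ u < n ] (δᶠ x u * (s u * t y)) + ∑[ u < n ] (δᶠ y u * (s u * t x))
      ≡⟨ cong₂ _+_ (∑-δ x (λ u → s u * t y)) (∑-δ y (λ u → s u * t x)) ⟩
    s x * t y + s y * t x ∎
    where
      open ≡-Reasoning
      pull : ∀ a b (f : Fin n → ℕ) → ∑[ v < n ] (a * (b * f v)) ≡ a * (b * ∑[ v < n ] f v)
      pull a b f = trans (sym (*-distribˡ-sum a (λ v → b * f v))) (cong (a *_) (sym (*-distribˡ-sum b f)))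

  multiplicity-sum : ∀ es → ∑[ u < n ] ∑[ v < n ] (s u * t v * multiplicity (finV n) es u v) ≡ ∑[ e ∈ es ] weight e
  multiplicity-sum []       = ∑-zero _ (λ u → ∑-zero _ (λ v → *-zeroʳ (s u * t v)))
  multiplicity-sum (e ∷ es) = begin
    ∑[ u < n ] ∑[ v < n ] (s u * t v * (hits (finV n) e u v + multiplicity (finV n) es u v))
      ≡⟨ sum-cong-≗ (λ u → trans (sum-cong-≗ (λ v → *-distribˡ-+ (s u * t v) _ _)) (∑-distrib-+ (λ v → s u * t v * hits (finV n) e u v) (λ v → s u * t v * multiplicity (finV n) es u v))) ⟩
    ∑[ u < n ] (∑[ v < n ] (s u * t v * hits (finV n) e u v) + ∑[ v < n ] (s u * t v * multiplicity (finV n) es u v))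
      ≡⟨ ∑-distrib-+ (λ u → ∑[ v < n ] (s u * t v * hits (finV n) e u v)) (λ u → ∑[ v < n ] (s u * t v * multiplicity (finV n) es u v)) ⟩
    ∑[ u < n ] ∑[ v < n ] (s u * t v * hits (finV n) e u v) + ∑[ u < n ] ∑[ v < n ] (s u * t v * multiplicity (finV n) es u v)
      ≡⟨ cong₂ _+_ (hits-sum e) (multiplicity-sum es) ⟩
    weight e + ∑[ e ∈ es ] weight e ∎
    where open ≡-Reasoning

  quadratic : ∀ es → (∀ u v → multiplicity (finV n) es u v + δᶠ u v ≡ 1) →
    ∑[ e ∈ es ] weight e + ∑[ u < n ] (s u * t u) ≡ ∑[ u < n ] s u * ∑[ v < n ] t v
  quadratic es once = sym (begin
    ∑[ u < n ] s u * ∑[ v < n ] t v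
      ≡⟨ *-distribʳ-sum (∑[ v < n ] t v) s ⟩
    ∑[ u < n ] (s u * ∑[ v < n ] t v)
      ≡⟨ sum-cong-≗ (λ u → *-distribˡ-sum (s u) t) ⟩
    ∑[ u < n ] ∑[ v < n ] (s u * t v)
      ≡⟨ sum-cong-≗ (λ u → sum-cong-≗ (λ v → trans (sym (*-identityʳ (s u * t v))) (cong (s u * t v *_) (sym (once u v))))) ⟩
    ∑[ u < n ] ∑[ v < n ] (s u * t v * (multiplicity (finV n) es u v + δᶠ u v))
      ≡⟨ sum-cong-≗ (λ u → trans (sum-cong-≗ (λ v → *-distribˡ-+ (s u * t v) _ _)) (∑-distrib-+ (λ v → s u * t v * multiplicity (finV n) es u v) (λ v → s u * t v * δᶠ u v))) ⟩
    ∑[ u < n ] (∑[ v < n ] (s u * t v * multiplicity (finV n) es u v) + ∑[ v < n ] (s u * t v * δᶠ u v))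
      ≡⟨ ∑-distrib-+ (λ u → ∑[ v < n ] (s u * t v * multiplicity (finV n) es u v)) (λ u → ∑[ v < n ] (s u * t v * δᶠ u v)) ⟩
    ∑[ u < n ] ∑[ v < n ] (s u * t v * multiplicity (finV n) es u v) + ∑[ u < n ] ∑[ v < n ] (s u * t v * δᶠ u v)
      ≡⟨ cong₂ _+_ (multiplicity-sum es) (sum-cong-≗ diagonal) ⟩
    ∑[ e ∈ es ] weight e + ∑[ u < n ] (s u * t u) ∎)
    where
      open ≡-Reasoning
      diagonal : ∀ u → ∑[ v < n ] (s u * t v * δᶠ u v) ≡ s u * t u
      diagonal u = trans (sum-cong-≗ (λ v → *-comm (s u * t v) (δᶠ u v))) (∑-δ u (λ v → s u * t v))

-- Which pattern a shape is, and its (constant) vertex degree: C₆ is 2-regular, C̄₆ is 3-regular.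
isCycle isCoCycle : Shape → ℕ
isCycle cycle6    = 1
isCycle co-cycle6 = 0
isCoCycle cycle6    = 0
isCoCycle co-cycle6 = 1

degree : Shape → ℕ
degree s = 2 + isCoCycle s

patternDegree : List (Fin 6 × Fin 6) → Fin 6 → ℕ
patternDegree L k = ∑[ p ∈ L ] (δᶠ (proj₁ p) k + δᶠ (proj₂ p) k)

regular : ∀ s k → patternDegree (shapeEdges s) k ≡ degree s
regular cycle6    = toWitness {a? = all? λ k → patternDegree C6-edges k ℕ.≟ 2} _
regular co-cycle6 = toWitness {a? = all? λ k → patternDegree C6bar-edges k ℕ.≟ 3} _

handshake : ∀ L (a : Fin 6 → ℕ) → ∑[ p ∈ L ] (a (proj₁ p) + a (proj₂ p)) ≡ ∑[ k < 6 ] (a k * patternDegree L k)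
handshake []            a = sym (∑-zero (λ k → a k * 0) (λ k → *-zeroʳ (a k)))
handshake ((i , j) ∷ L) a = begin
  a i + a j + ∑[ p ∈ L ] (a (proj₁ p) + a (proj₂ p))
    ≡⟨ cong₂ _+_ endpoints (handshake L a) ⟩
  ∑[ k < 6 ] (a k * (δᶠ i k + δᶠ j k)) + ∑[ k < 6 ] (a k * patternDegree L k)
    ≡⟨ ∑-distrib-+ (λ k → a k * (δᶠ i k + δᶠ j k)) (λ k → a k * patternDegree L k) ⟨
  ∑[ k < 6 ] (a k * (δᶠ i k + δᶠ j k) + a k * patternDegree L k)
    ≡⟨ sum-cong-≗ (λ k → *-distribˡ-+ (a k) (δᶠ i k + δᶠ j k) (patternDegree L k)) ⟨
  ∑[ k < 6 ] (a k * patternDegree ((i , j) ∷ L) k) ∎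
  where
    open ≡-Reasoning
    endpoints : a i + a j ≡ ∑[ k < 6 ] (a k * (δᶠ i k + δᶠ j k))
    endpoints = begin
      a i + a j                                        ≡⟨ cong₂ _+_ (∑-δ i a) (∑-δ j a) ⟨
      ∑[ k < 6 ] (δᶠ i k * a k) + ∑[ k < 6 ] (δᶠ j k * a k) ≡⟨ ∑-distrib-+ (λ k → δᶠ i k * a k) (λ k → δᶠ j k * a k) ⟨
      ∑[ k < 6 ] (δᶠ i k * a k + δᶠ j k * a k)          ≡⟨ sum-cong-≗ (λ k → trans (cong₂ _+_ (*-comm (δᶠ i k) (a k)) (*-comm (δᶠ j k) (a k))) (sym (*-distribˡ-+ (a k) _ _))) ⟩
      ∑[ k < 6 ] (a k * (δᶠ i k + δᶠ j k))              ∎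

module _ {n : ℕ} where

  occurrences : Block n → Fin n → ℕ
  occurrences b v = ∑[ i < 6 ] δᶠ (emb b i) v

  blockDegree : ∀ b (a : Fin n → ℕ) →
    ∑[ e ∈ blockEdges b ] (a (proj₁ e) * 1 + a (proj₂ e) * 1) ≡ ∑[ i < 6 ] a (emb b i) * degree (shape b)
  blockDegree b a = begin
    ∑[ e ∈ blockEdges b ] (a (proj₁ e) * 1 + a (proj₂ e) * 1)
      ≡⟨ listSum-map _ (shapeEdges (shape b)) (λ e → a (proj₁ e) * 1 + a (proj₂ e) * 1) ⟩
    ∑[ p ∈ shapeEdges (shape b) ] (a (emb b (proj₁ p)) * 1 + a (emb b (proj₂ p)) * 1)
      ≡⟨ listSum-cong (shapeEdges (shape b)) (λ p → cong₂ _+_ (*-identityʳ (a (emb b (proj₁ p)))) (*-identityʳ (a (emb b (proj₂ p))))) ⟩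
    ∑[ p ∈ shapeEdges (shape b) ] (a (emb b (proj₁ p)) + a (emb b (proj₂ p)))
      ≡⟨ handshake (shapeEdges (shape b)) (λ i → a (emb b i)) ⟩
    ∑[ i < 6 ] (a (emb b i) * patternDegree (shapeEdges (shape b)) i)
      ≡⟨ sum-cong-≗ (λ i → cong (a (emb b i) *_) (regular (shape b) i)) ⟩
    ∑[ i < 6 ] (a (emb b i) * degree (shape b))
      ≡⟨ *-distribʳ-sum (degree (shape b)) (λ i → a (emb b i)) ⟨
    ∑[ i < 6 ] a (emb b i) * degree (shape b) ∎
    where open ≡-Reasoning

  injective-meets-once : ∀ {k} (e : Fin k → Fin n) → Injective _≡_ _≡_ e → ∀ v → ∑[ i < k ] δᶠ (e i) v ≤ 1
  injective-meets-once {zero}  e e-inj v = z≤n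
  injective-meets-once {suc k} e e-inj v with e zero ≟ᶠ v
  ... | yes refl = ≤-reflexive (cong suc (∑-zero (λ i → δᶠ (e (suc i)) (e zero)) (λ i → δ-≢ (finV n) (0≢suc ∘ sym ∘ e-inj))))
    where
      0≢suc : ∀ {i : Fin k} → zero ≢ suc i
      0≢suc ()
  ... | no _     = injective-meets-once (e ∘ suc) (suc-injective ∘ e-inj) v

  occurrences≤1 : ∀ b v → occurrences b v ≤ 1
  occurrences≤1 b = injective-meets-once (emb b) (inj b)

  ∑-occurrences : ∀ b (f : Fin n → ℕ) → ∑[ v < n ] (f v * occurrences b v) ≡ ∑[ i < 6 ] f (emb b i)
  ∑-occurrences b f = begin
    ∑[ v < n ] (f v * ∑[ i < 6 ] δᶠ (emb b i) v)   ≡⟨ sum-cong-≗ (λ v → *-distribˡ-sum (f v) (λ i → δᶠ (emb b i) v)) ⟩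
    ∑[ v < n ] ∑[ i < 6 ] (f v * δᶠ (emb b i) v)   ≡⟨ ∑-comm (λ v i → f v * δᶠ (emb b i) v) ⟩
    ∑[ i < 6 ] ∑[ v < n ] (f v * δᶠ (emb b i) v)   ≡⟨ sum-cong-≗ (λ i → trans (sum-cong-≗ (λ v → *-comm (f v) (δᶠ (emb b i) v))) (∑-δ (emb b i) f)) ⟩
    ∑[ i < 6 ] f (emb b i)                          ∎
    where open ≡-Reasoning

bit : Bool → ℕ
bit true  = 1
bit false = 0

every : (Bool → Bool) → Bool
every p = p true ∧ p false

every-sound : ∀ p → T (every p) → ∀ b → T (p b)
every-sound p holds true  = proj₁ (T-∧ .Equivalence.to holds)
every-sound p holds false = proj₂ (T-∧ .Equivalence.to holds)

every⁶ : (Bool → Bool → Bool → Bool → Bool → Bool → Bool) → Bool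
every⁶ p = every λ x₀ → every λ x₁ → every λ x₂ → every λ x₃ → every λ x₄ → every (p x₀ x₁ x₂ x₃ x₄)

every⁶-sound : ∀ p → T (every⁶ p) → ∀ b₀ b₁ b₂ b₃ b₄ b₅ → T (p b₀ b₁ b₂ b₃ b₄ b₅)
every⁶-sound p holds b₀ b₁ b₂ b₃ b₄ b₅ =
  every-sound (p b₀ b₁ b₂ b₃ b₄)
   (every-sound (λ x₄ → every (p b₀ b₁ b₂ b₃ x₄))
    (every-sound (λ x₃ → every λ x₄ → every (p b₀ b₁ b₂ x₃ x₄))
     (every-sound (λ x₂ → every λ x₃ → every λ x₄ → every (p b₀ b₁ x₂ x₃ x₄))
      (every-sound (λ x₁ → every λ x₂ → every λ x₃ → every λ x₄ → every (p b₀ x₁ x₂ x₃ x₄))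
       (every-sound (λ x₀ → every λ x₁ → every λ x₂ → every λ x₃ → every λ x₄ → every (p x₀ x₁ x₂ x₃ x₄))
        holds b₀) b₁) b₂) b₃) b₄) b₅

-- Twice the number of edges of C̄₆ inside the vertex set marked by c.
insidePrism : (Fin 6 → Bool) → ℕ
insidePrism c = ∑[ p ∈ C6bar-edges ] (bit (c (proj₁ p)) * bit (c (proj₂ p)) + bit (c (proj₂ p)) * bit (c (proj₁ p)))

-- Deleting a vertex of C̄₆ destroys at most three edges, so k marked vertices span at least
-- 3k − 9 edges; checked over all 64 markings.
prism-bound : ∀ c → 6 * ∑[ i < 6 ] bit (c i) ≤ insidePrism c + 18
prism-bound c = ≤ᵇ⇒≤ _ _ (every⁶-sound check _ (c v0) (c v1) (c v2) (c v3) (c v4) (c v5))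
  where
    check : Bool → Bool → Bool → Bool → Bool → Bool → Bool
    check b₀ b₁ b₂ b₃ b₄ b₅ = 6 * ∑[ i < 6 ] bit (marking i) ℕ.≤ᵇ insidePrism marking + 18
      where
        marking : Fin 6 → Bool
        marking = lookup (b₀ ∷ b₁ ∷ b₂ ∷ b₃ ∷ b₄ ∷ b₅ ∷ [])

-- Edge lists without loops; the edges of a block join distinct vertices, so a diagonal pair
-- {u , u} has multiplicity 0.
Loopless : ∀ {X : Set} → List (X × X) → Set
Loopless = All (λ e → proj₁ e ≢ proj₂ e)

shapeEdges-loopless : ∀ s → Loopless (shapeEdges s)
shapeEdges-loopless cycle6    = toWitness {a? = All.all? (λ e → ¬? (proj₁ e ≟ᶠ proj₂ e)) C6-edges} _
shapeEdges-loopless co-cycle6 = toWitness {a? = All.all? (λ e → ¬? (proj₁ e ≟ᶠ proj₂ e)) C6bar-edges} _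

blockEdges-loopless : ∀ {n} (b : Block n) → Loopless (blockEdges b)
blockEdges-loopless b = AllProperties.map⁺ (All.map (λ i≢j → i≢j ∘ inj b) (shapeEdges-loopless (shape b)))

loopless-diagonal : ∀ {n} (es : List (Fin n × Fin n)) → Loopless es → ∀ u → multiplicity (finV n) es u u ≡ 0
loopless-diagonal []             []           u = refl
loopless-diagonal ((x , y) ∷ es) (x≢y ∷ rest) u =
  cong₂ _+_ (cong₂ _+_ apart apart) (loopless-diagonal es rest u)
  where
    apart : δᶠ x u * δᶠ y u ≡ 0
    apart with x ≟ᶠ u
    ... | yes refl = trans (*-identityˡ (δᶠ y x)) (δ-≢ (finV _) (x≢y ∘ sym))
    ... | no _     = refl

module Counting {n} (bs : List (Block n)) (partition : IsEdgePartition bs) where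

  edges : List (Fin n × Fin n)
  edges = concatMap blockEdges bs

  loopless : ∀ (cs : List (Block n)) → Loopless (concatMap blockEdges cs)
  loopless []       = []
  loopless (c ∷ cs) = AllProperties.++⁺ (blockEdges-loopless c) (loopless cs)

  once : ∀ u v → multiplicity (finV n) edges u v + δᶠ u v ≡ 1
  once u v with u ≟ᶠ v
  ... | yes refl = cong (_+ 1) (loopless-diagonal edges (loopless bs) u)
  ... | no u≢v   = cong₂ _+_ (trans (sym (edgeCount≡multiplicity edges u v u≢v)) (partition u v u≢v)) refl

  blockwise : ∀ s t → ∑[ b ∈ bs ] ∑[ e ∈ blockEdges b ] Quadratic.weight s t e + ∑[ u < n ] (s u * t u)
                      ≡ ∑[ u < n ] s u * ∑[ v < n ] t v
  blockwise s t = trans (cong (_+ ∑[ u < n ] (s u * t u)) (sym (listSum-concatMap blockEdges bs (Quadratic.weight s t))))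
                        (Quadratic.quadratic s t edges once)

  -- Numbers of copies of C₆ and of C̄₆; for a vertex v, the number D v of copies through v
  -- and the number β v of copies of C̄₆ through v.
  A B : ℕ
  A = ∑[ b ∈ bs ] isCycle (shape b)
  B = ∑[ b ∈ bs ] isCoCycle (shape b)

  D β : Fin n → ℕ
  D v = ∑[ b ∈ bs ] occurrences b v
  β v = ∑[ b ∈ bs ] (isCoCycle (shape b) * occurrences b v)

  column : ∀ v → ∑[ u < n ] (δᶠ u v * 1) ≡ 1
  column v = trans (sum-cong-≗ (λ u → cong (_* 1) (δ-sym (finV n) u v))) (∑-δ v (λ _ → 1))

  edgeTotal : A * 12 + B * 18 + n ≡ n * n
  edgeTotal = begin
    A * 12 + B * 18 + n
      ≡⟨ cong₂ _+_ perBlock (sym (∑-ones n)) ⟩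
    ∑[ b ∈ bs ] ∑[ e ∈ blockEdges b ] Quadratic.weight one one e + ∑[ u < n ] (1 * 1)
      ≡⟨ blockwise one one ⟩
    ∑[ u < n ] 1 * ∑[ v < n ] 1
      ≡⟨ cong₂ _*_ (∑-ones n) (∑-ones n) ⟩
    n * n ∎
    where
      open ≡-Reasoning
      one : Fin n → ℕ
      one _ = 1
      sixDegree : ∀ s → 6 * degree s ≡ isCycle s * 12 + isCoCycle s * 18
      sixDegree cycle6    = refl
      sixDegree co-cycle6 = refl
      perBlock : A * 12 + B * 18 ≡ ∑[ b ∈ bs ] ∑[ e ∈ blockEdges b ] Quadratic.weight one one e
      perBlock = begin
        A * 12 + B * 18
          ≡⟨ cong₂ _+_ (listSum-*ʳ bs 12 (isCycle ∘ shape)) (listSum-*ʳ bs 18 (isCoCycle ∘ shape)) ⟨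
        ∑[ b ∈ bs ] (isCycle (shape b) * 12) + ∑[ b ∈ bs ] (isCoCycle (shape b) * 18)
          ≡⟨ listSum-+ bs (λ b → isCycle (shape b) * 12) (λ b → isCoCycle (shape b) * 18) ⟨
        ∑[ b ∈ bs ] (isCycle (shape b) * 12 + isCoCycle (shape b) * 18)
          ≡⟨ listSum-cong bs (λ b → sym (trans (blockDegree b one) (sixDegree (shape b)))) ⟩
        ∑[ b ∈ bs ] ∑[ e ∈ blockEdges b ] Quadratic.weight one one e ∎

  vertexDegree : ∀ v → D v * 2 + β v + 1 ≡ n
  vertexDegree v = begin
    D v * 2 + β v + 1
      ≡⟨ cong₂ _+_ perBlock (sym (column v)) ⟩
    ∑[ b ∈ bs ] ∑[ e ∈ blockEdges b ] Quadratic.weight at-v one e + ∑[ u < n ] (δᶠ u v * 1)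
      ≡⟨ blockwise at-v one ⟩
    ∑[ u < n ] δᶠ u v * ∑[ u < n ] 1
      ≡⟨ cong₂ _*_ (trans (sum-cong-≗ (λ u → sym (*-identityʳ (δᶠ u v)))) (column v)) (∑-ones n) ⟩
    1 * n
      ≡⟨ *-identityˡ n ⟩
    n ∎
    where
      open ≡-Reasoning
      one at-v : Fin n → ℕ
      one _ = 1
      at-v u = δᶠ u v
      split : ∀ k c → k * (2 + c) ≡ k * 2 + c * k
      split = solve-∀
      perBlock : D v * 2 + β v ≡ ∑[ b ∈ bs ] ∑[ e ∈ blockEdges b ] Quadratic.weight at-v one e
      perBlock = begin
        D v * 2 + β v
          ≡⟨ cong (_+ β v) (listSum-*ʳ bs 2 (λ b → occurrences b v)) ⟨
        ∑[ b ∈ bs ] (occurrences b v * 2) + β v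
          ≡⟨ listSum-+ bs (λ b → occurrences b v * 2) (λ b → isCoCycle (shape b) * occurrences b v) ⟨
        ∑[ b ∈ bs ] (occurrences b v * 2 + isCoCycle (shape b) * occurrences b v)
          ≡⟨ listSum-cong bs (λ b → sym (trans (blockDegree b at-v) (split (occurrences b v) (isCoCycle (shape b))))) ⟩
        ∑[ b ∈ bs ] ∑[ e ∈ blockEdges b ] Quadratic.weight at-v one e ∎

  -- A vertex lies on each copy of C̄₆ at most once.
  β≤B : ∀ v → β v ≤ B
  β≤B v = listSum-mono bs (λ b → ≤-trans (*-monoʳ-≤ (isCoCycle (shape b)) (occurrences≤1 b v))
                                        (≤-reflexive (*-identityʳ (isCoCycle (shape b)))))

  ∑-β : ∀ (f : Fin n → ℕ) → ∑[ v < n ] (f v * β v) ≡ ∑[ b ∈ bs ] (isCoCycle (shape b) * ∑[ i < 6 ] f (emb b i))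
  ∑-β f = begin
    ∑[ v < n ] (f v * ∑[ b ∈ bs ] (isCoCycle (shape b) * occurrences b v))
      ≡⟨ sum-cong-≗ (λ v → listSum-*ˡ bs (f v) (λ b → isCoCycle (shape b) * occurrences b v)) ⟨
    ∑[ v < n ] ∑[ b ∈ bs ] (f v * (isCoCycle (shape b) * occurrences b v))
      ≡⟨ ∑-listSum-comm n bs (λ v b → f v * (isCoCycle (shape b) * occurrences b v)) ⟩
    ∑[ b ∈ bs ] ∑[ v < n ] (f v * (isCoCycle (shape b) * occurrences b v))
      ≡⟨ listSum-cong bs perBlock ⟩
    ∑[ b ∈ bs ] (isCoCycle (shape b) * ∑[ i < 6 ] f (emb b i)) ∎
    where
      open ≡-Reasoning
      swap : ∀ x c k → x * (c * k) ≡ c * (x * k)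
      swap = solve-∀
      perBlock : ∀ b → ∑[ v < n ] (f v * (isCoCycle (shape b) * occurrences b v)) ≡ isCoCycle (shape b) * ∑[ i < 6 ] f (emb b i)
      perBlock b = begin
        ∑[ v < n ] (f v * (isCoCycle (shape b) * occurrences b v))
          ≡⟨ sum-cong-≗ (λ v → swap (f v) (isCoCycle (shape b)) (occurrences b v)) ⟩
        ∑[ v < n ] (isCoCycle (shape b) * (f v * occurrences b v))
          ≡⟨ *-distribˡ-sum (isCoCycle (shape b)) (λ v → f v * occurrences b v) ⟨
        isCoCycle (shape b) * ∑[ v < n ] (f v * occurrences b v)
          ≡⟨ cong (isCoCycle (shape b) *_) (∑-occurrences b f) ⟩
        isCoCycle (shape b) * ∑[ i < 6 ] f (emb b i) ∎

  -- Every copy of C̄₆ has six vertices.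
  ∑β : ∑[ v < n ] β v ≡ B * 6
  ∑β = begin
    ∑[ v < n ] β v                                      ≡⟨ sum-cong-≗ (λ v → *-identityˡ (β v)) ⟨
    ∑[ v < n ] (1 * β v)                                ≡⟨ ∑-β (λ _ → 1) ⟩
    ∑[ b ∈ bs ] (isCoCycle (shape b) * 6)               ≡⟨ listSum-*ʳ bs 6 (isCoCycle ∘ shape) ⟩
    B * 6                                               ∎
    where open ≡-Reasoning

  module Marked (marked : Fin n → Bool) where

    χ : Fin n → ℕ
    χ = bit ∘ marked

    -- |S| and twice the number of edges inside S.
    size inside : ℕ
    size   = ∑[ u < n ] χ u
    inside = ∑[ b ∈ bs ] ∑[ e ∈ blockEdges b ] Quadratic.weight χ χ e

    squareSize : inside + size ≡ size * size
    squareSize = trans (cong (inside +_) (sum-cong-≗ (λ u → sym (idempotent (marked u))))) (blockwise χ χ)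
      where
        idempotent : ∀ x → bit x * bit x ≡ bit x
        idempotent true  = refl
        idempotent false = refl

    -- Each copy of C̄₆ with k vertices in S has at least 3k − 9 edges inside S.
    insidePrisms : 6 * ∑[ v < n ] (χ v * β v) ≤ inside + B * 18
    insidePrisms = begin
      6 * ∑[ v < n ] (χ v * β v)
        ≡⟨ cong (6 *_) (∑-β χ) ⟩
      6 * ∑[ b ∈ bs ] (isCoCycle (shape b) * ∑[ i < 6 ] χ (emb b i))
        ≡⟨ listSum-*ˡ bs 6 (λ b → isCoCycle (shape b) * ∑[ i < 6 ] χ (emb b i)) ⟨
      ∑[ b ∈ bs ] (6 * (isCoCycle (shape b) * ∑[ i < 6 ] χ (emb b i)))
        ≤⟨ listSum-mono bs perBlock ⟩
      ∑[ b ∈ bs ] (∑[ e ∈ blockEdges b ] Quadratic.weight χ χ e + isCoCycle (shape b) * 18)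
        ≡⟨ listSum-+ bs (λ b → ∑[ e ∈ blockEdges b ] Quadratic.weight χ χ e) (λ b → isCoCycle (shape b) * 18) ⟩
      inside + ∑[ b ∈ bs ] (isCoCycle (shape b) * 18)
        ≡⟨ cong (inside +_) (listSum-*ʳ bs 18 (isCoCycle ∘ shape)) ⟩
      inside + B * 18 ∎
      where
        open ≤-Reasoning
        perBlock : ∀ b → 6 * (isCoCycle (shape b) * ∑[ i < 6 ] χ (emb b i))
                         ≤ ∑[ e ∈ blockEdges b ] Quadratic.weight χ χ e + isCoCycle (shape b) * 18
        perBlock (block cycle6    e _) = z≤n
        perBlock (block co-cycle6 e _) =
          ≤-trans (≤-reflexive (cong (6 *_) (*-identityˡ (∑[ i < 6 ] χ (e i))))) (prism-bound (marked ∘ e))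

bySearch : ∀ K L (P : ℕ → ℕ → Set) (P? : ∀ a b → Dec (P a b)) →
  {True (allUpTo? (λ a → allUpTo? (P? a) L) K)} → ∀ {a b} → a < K → b < L → P a b
bySearch K L P P? {ok} a<K b<L = toWitness ok a<K b<L

CopyCounts : ℕ → (ℕ → Set) → ℕ → ℕ → Set
CopyCounts M R a b = a * 12 + b * 18 ≡ M → 1 ≤ a → 1 ≤ b → R b

copyCounts? : ∀ M {R : ℕ → Set} → (∀ b → Dec (R b)) → ∀ a b → Dec (CopyCounts M R a b)
copyCounts? M R? a b = (a * 12 + b * 18 ℕ.≟ M) →-dec ((1 ℕ.≤? a) →-dec ((1 ℕ.≤? b) →-dec R? b))

copyCounts : ∀ M {R : ℕ → Set} (R? : ∀ b → Dec (R b)) →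
  {True (allUpTo? (λ a → allUpTo? (copyCounts? M R? a) (suc M)) (suc M))} → ∀ a b → CopyCounts M R a b
copyCounts M {R} R? {ok} a b eq =
  bySearch (suc M) (suc M) (CopyCounts M R) (copyCounts? M R?) {ok}
    (s≤s (≤-trans (m≤m*n a 12) (≤-trans (m≤m+n (a * 12) (b * 18)) (≤-reflexive eq))))
    (s≤s (≤-trans (m≤m*n b 18) (≤-trans (m≤n+m (b * 18) (a * 12)) (≤-reflexive eq))))
    eq

DegreeValues : ℕ → ℕ → (ℕ → Set) → ℕ → ℕ → Set
DegreeValues N c R d x = d * 2 + x + 1 ≡ N → x ≤ c → R x

degreeValues? : ∀ N c {R : ℕ → Set} → (∀ x → Dec (R x)) → ∀ d x → Dec (DegreeValues N c R d x)
degreeValues? N c R? d x = (d * 2 + x + 1 ℕ.≟ N) →-dec ((x ℕ.≤? c) →-dec R? x)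

degreeValues : ∀ N c {R : ℕ → Set} (R? : ∀ x → Dec (R x)) →
  {True (allUpTo? (λ d → allUpTo? (degreeValues? N c R? d) (suc c)) (suc N))} → ∀ d x → DegreeValues N c R d x
degreeValues N c {R} R? {ok} d x eq x≤c =
  bySearch (suc N) (suc c) (DegreeValues N c R) (degreeValues? N c R?) {ok}
    (s≤s (≤-trans (m≤m*n d 2) (≤-trans (m≤m+n (d * 2) x) (≤-trans (m≤m+n (d * 2 + x) 1) (≤-reflexive eq)))))
    (s≤s x≤c) eq x≤c

-- When β takes only two values, mark the vertices carrying the larger one; these identities
-- express β and χ · β through the marking.
zeroOrTwo : ∀ {x} → x ≡ 0 ⊎ x ≡ 2 → bit (x ≡ᵇ 2) * x ≡ x × bit (x ≡ᵇ 2) * x ≡ 2 * bit (x ≡ᵇ 2)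
zeroOrTwo (inj₁ refl) = refl , refl
zeroOrTwo (inj₂ refl) = refl , refl

oneOrThree : ∀ {x} → x ≡ 1 ⊎ x ≡ 3 → x ≡ 1 + 2 * bit (x ≡ᵇ 3) × bit (x ≡ᵇ 3) * x ≡ 3 * bit (x ≡ᵇ 3)
oneOrThree (inj₁ refl) = refl , refl
oneOrThree (inj₂ refl) = refl , refl

module Necessary {n} (bs : List (Block n)) (partition : IsEdgePartition bs)
  (withCycle : Any (λ b → shape b ≡ cycle6) bs) (withCoCycle : Any (λ b → shape b ≡ co-cycle6) bs) where

  open Counting bs partition

  A≥1 : 1 ≤ A
  A≥1 = listSum-positive bs (isCycle ∘ shape) (λ { (block cycle6 _ _) _ → s≤s z≤n ; (block co-cycle6 _ _) () }) withCycle

  B≥1 : 1 ≤ B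
  B≥1 = listSum-positive bs (isCoCycle ∘ shape) (λ { (block co-cycle6 _ _) _ → s≤s z≤n ; (block cycle6 _ _) () }) withCoCycle

  -- A copy of C₆ needs six vertices.
  atLeastSix : 6 ≤ n
  atLeastSix = injective⇒≤ (inj (proj₁ (satisfied withCycle)))

  -- 3 divides 12A + 18B = n (n − 1), so n ≢ 2 (mod 3).
  residue : n % 3 ≡ 0 ⊎ n % 3 ≡ 1
  residue with n % 3 in r | m%n<n n 3
  ... | 0 | _ = inj₁ refl
  ... | 1 | _ = inj₂ refl
  ... | 2 | _ = ⊥-elim (1≢2 (begin
    1                     ≡⟨⟩
    (2 * 2) % 3           ≡⟨ cong (λ k → (k * k) % 3) r ⟨
    ((n % 3) * (n % 3)) % 3 ≡⟨ %-distribˡ-* n n 3 ⟨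
    (n * n) % 3           ≡⟨ cong (_% 3) (trans (sym edgeTotal) (regroup A B n)) ⟩
    (n + (A * 4 + B * 6) * 3) % 3 ≡⟨ [m+kn]%n≡m%n n (A * 4 + B * 6) 3 ⟩
    n % 3                 ≡⟨ r ⟩
    2                     ∎))
    where
      open ≡-Reasoning
      1≢2 : 1 ≢ 2
      1≢2 ()
      regroup : ∀ a b m → a * 12 + b * 18 + m ≡ m + (a * 4 + b * 6) * 3
      regroup = solve-∀
  ... | suc (suc (suc _)) | s≤s (s≤s (s≤s ()))

  copiesFor : ∀ N → n ≡ N → A * 12 + B * 18 + N ≡ N * N
  copiesFor N refl = edgeTotal

  degreeFor : ∀ N → n ≡ N → ∀ v → D v * 2 + β v + 1 ≡ N
  degreeFor N refl = vertexDegree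

  -- A set meeting the copies of C̄₆ twelve times but spanning few edges violates the prism bound.
  prismClash : ∀ marked → ∑[ v < n ] (Marked.χ marked v * β v) ≡ 12 → Marked.inside marked + B * 18 ≡ 66 → ⊥
  prismClash marked incidences room =
    refute (subst₂ _≤_ (cong (6 *_) incidences) room (Marked.insidePrisms marked))

  -- K_7: one copy of C̄₆, but every vertex has even β, hence β = 0 — yet the copy has six vertices.
  not7 : n ≢ 7
  not7 n≡7 = six≢0 (begin
    6              ≡⟨ cong (_* 6) B≡1 ⟨
    B * 6          ≡⟨ ∑β ⟨
    ∑[ v < n ] β v ≡⟨ ∑-zero β β≡0 ⟩
    0              ∎)
    where
      open ≡-Reasoning
      six≢0 : 6 ≢ 0
      six≢0 ()
      B≡1 : B ≡ 1
      B≡1 = copyCounts 42 (ℕ._≟ 1) A B (+-cancelʳ-≡ 7 _ 42 (copiesFor 7 n≡7)) A≥1 B≥1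
      β≡0 : ∀ v → β v ≡ 0
      β≡0 v = degreeValues 7 1 (ℕ._≟ 0) (D v) (β v) (degreeFor 7 n≡7 v) (subst (β v ≤_) B≡1 (β≤B v))

  -- K_9: two copies of C̄₆, both on the same six vertices, which span only 15 < 18 edges.
  not9 : n ≢ 9
  not9 n≡9 = prismClash on-both incidences (cong₂ (λ i b → i + b * 18) inside≡30 B≡2)
    where
      open ≡-Reasoning
      B≡2 : B ≡ 2
      B≡2 = copyCounts 72 (ℕ._≟ 2) A B (+-cancelʳ-≡ 9 _ 72 (copiesFor 9 n≡9)) A≥1 B≥1
      on-both : Fin n → Bool
      on-both v = β v ≡ᵇ 2
      open Marked on-both
      values : ∀ v → χ v * β v ≡ β v × χ v * β v ≡ 2 * χ v
      values v = zeroOrTwo (degreeValues 9 2 (λ x → (x ℕ.≟ 0) ⊎-dec (x ℕ.≟ 2)) (D v) (β v) (degreeFor 9 n≡9 v) (subst (β v ≤_) B≡2 (β≤B v)))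
      incidences : ∑[ v < n ] (χ v * β v) ≡ 12
      incidences = trans (sum-cong-≗ (proj₁ ∘ values)) (trans ∑β (cong (_* 6) B≡2))
      size≡6 : size ≡ 6
      size≡6 = *-cancelˡ-≡ size 6 2 (begin
        2 * size                     ≡⟨ *-distribˡ-sum 2 χ ⟩
        ∑[ v < n ] (2 * χ v)          ≡⟨ sum-cong-≗ (proj₂ ∘ values) ⟨
        ∑[ v < n ] (χ v * β v)        ≡⟨ incidences ⟩
        12                           ∎)
      inside≡30 : inside ≡ 30
      inside≡30 = +-cancelʳ-≡ 6 inside 30 (trans (cong (inside +_) (sym size≡6)) (trans squareSize (cong₂ _*_ size≡6 size≡6)))

  -- K_10 with one copy of C̄₆: every vertex has odd β ≤ 1, so all ten vertices lie on it.
  tenWithOneCoCycle : n ≡ 10 → B ≡ 1 → ⊥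
  tenWithOneCoCycle n≡10 B≡1 = ten≢six (begin
    10              ≡⟨ n≡10 ⟨
    n               ≡⟨ ∑-ones n ⟨
    ∑[ v < n ] 1    ≡⟨ sum-cong-≗ β≡1 ⟨
    ∑[ v < n ] β v  ≡⟨ ∑β ⟩
    B * 6           ≡⟨ cong (_* 6) B≡1 ⟩
    6               ∎)
    where
      open ≡-Reasoning
      ten≢six : 10 ≢ 6
      ten≢six ()
      β≡1 : ∀ v → β v ≡ 1
      β≡1 v = degreeValues 10 1 (ℕ._≟ 1) (D v) (β v) (degreeFor 10 n≡10 v) (subst (β v ≤_) B≡1 (β≤B v))

  -- K_10 with three copies of C̄₆: β ∈ {1, 3}, and the four vertices on all three copies
  -- span only 6 < 9 of the edges the copies need there.
  tenWithThreeCoCycles : n ≡ 10 → B ≡ 3 → ⊥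
  tenWithThreeCoCycles n≡10 B≡3 = prismClash on-all incidences (cong₂ (λ i b → i + b * 18) inside≡12 B≡3)
    where
      open ≡-Reasoning
      on-all : Fin n → Bool
      on-all v = β v ≡ᵇ 3
      open Marked on-all
      values : ∀ v → β v ≡ 1 + 2 * χ v × χ v * β v ≡ 3 * χ v
      values v = oneOrThree (degreeValues 10 3 (λ x → (x ℕ.≟ 1) ⊎-dec (x ℕ.≟ 3)) (D v) (β v) (degreeFor 10 n≡10 v) (subst (β v ≤_) B≡3 (β≤B v)))
      size≡4 : size ≡ 4
      size≡4 = *-cancelˡ-≡ size 4 2 (+-cancelˡ-≡ 10 (2 * size) 8 (begin
        10 + 2 * size                        ≡⟨ cong₂ _+_ (trans (sym n≡10) (sym (∑-ones n))) (*-distribˡ-sum 2 χ) ⟩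
        ∑[ v < n ] 1 + ∑[ v < n ] (2 * χ v)  ≡⟨ ∑-distrib-+ (λ _ → 1) (λ v → 2 * χ v) ⟨
        ∑[ v < n ] (1 + 2 * χ v)             ≡⟨ sum-cong-≗ (proj₁ ∘ values) ⟨
        ∑[ v < n ] β v                       ≡⟨ trans ∑β (cong (_* 6) B≡3) ⟩
        18                                   ∎))
      incidences : ∑[ v < n ] (χ v * β v) ≡ 12
      incidences = begin
        ∑[ v < n ] (χ v * β v)  ≡⟨ sum-cong-≗ (proj₂ ∘ values) ⟩
        ∑[ v < n ] (3 * χ v)    ≡⟨ *-distribˡ-sum 3 χ ⟨
        3 * size                ≡⟨ cong (3 *_) size≡4 ⟩
        12                      ∎
      inside≡12 : inside ≡ 12
      inside≡12 = +-cancelʳ-≡ 4 inside 12 (trans (cong (inside +_) (sym size≡4)) (trans squareSize (cong₂ _*_ size≡4 size≡4)))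

  -- K_10: 12a + 18b = 90 leaves one or three copies of C̄₆.
  not10 : n ≢ 10
  not10 n≡10 = [ tenWithOneCoCycle n≡10 , tenWithThreeCoCycles n≡10 ]′
    (copyCounts 90 (λ b → (b ℕ.≟ 1) ⊎-dec (b ℕ.≟ 3)) A B (+-cancelʳ-≡ 10 _ 90 (copiesFor 10 n≡10)) A≥1 B≥1)

  necessary : Admissible n
  necessary = residue , atLeastSix , not7 , not9 , not10

theorem1 : (n : ℕ) → 1 ≤ n →
    (HasC6Multidecomposition n ⇔
      ((n % 3 ≡ 0 ⊎ n % 3 ≡ 1) × 6 ≤ n × n ≢ 7 × n ≢ 9 × n ≢ 10))
theorem1 n _ = mk⇔
  (λ { (bs , partition , withCycle , withCoCycle) → Necessary.necessary bs partition withCycle withCoCycle })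
  (multidecomposition ∘ sufficiency n)
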